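{- Let $d\ge 1$ and $n\ge 0$ be integers with $d$ dividing $n$, and consider the poset $\Omega_n^{(d)}$. Then: (a) $\Omega_n^{(d)}$ has a unique maximal element $\hat{1}=([n])$ (the ordered set partition with the single block $[n]$). (b) The atoms of $\Omega_n^{(d)}$ are exactly the ordered set partitions $\omega$ all of whose blocks $B$ satisfy $\#B=d$. (c) $\Omega_n^{(d)}$ is ranked, and the rank of an ordered set partition $\omega=(B_1,\ldots,B_k)$ is $\operatorname{rk}\omega = n/d-k+1$. The number of elements $\omega$ of corank $k$ is $(k+1)!\,S^{(d)}(n,k+1)$. (d) For any ordered set partition $\omega=(B_1,\ldots,B_k)$ in $\Omega_n^{(d)}$, the interval $[\omega,\hat 1]$ is isomorphic to the Boolean algebra $\mathcal{B}_{k-1}$. (e) For any ordered set partitions $\psi\le\omega$ in $\Omega_n^{(d)}$ (both different from $\hat 0$), $[\psi,\omega]\cong\mathcal{B}_{\operatorname{rk}(\psi,\omega)}$. (f) $\Omega_n^{(d)}$ is an atomic lattice, but it is not semimodular in general.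
   Context: $[n]=\{1,\ldots,n\}$. An ordered set partition of a finite set $S$ is a sequence $\omega=(B_1,\ldots,B_k)$ of nonempty pairwise disjoint subsets (blocks) of $S$ whose union is $S$; its length is $\ell(\omega)=k$. It is $d$-divisible if $d$ divides $\#B_i$ for all $i$. The $d$-divisible ordered set partitions of $[n]$ are partially ordered by declaring that $(B_1,\ldots,B_k)$ is covered by each $(B_1,\ldots,B_{i-1},B_i\cup B_{i+1},B_{i+2},\ldots,B_k)$, $1\le i<k$, and taking the transitive closure (so $\omega\le\psi$ iff each block of $\psi$ is a union of consecutive blocks of $\omega$, in the same left-to-right order). $\Omega_n^{(d)}$ is this poset with a new unique minimum $\hat0$ adjoined (for $n=0$ it is just $\{\hat 0\}$). For a ranked poset, $\operatorname{rk}(x,y)=\operatorname{rk}y-\operatorname{rk}x$ and, when there is a $\hat1$, $\operatorname{crk}x=\operatorname{rk}\hat1-\operatorname{rk}x$. $\mathcal{B}_j$ is the Boolean algebra of subsets of $[j]$ ordered by inclusion. $S^{(d)}(n,k)$ is the number of (unordered) set partitions of $[n]$ into $k$ blocks all of size divisible by $d$. -}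

module Defs where

open import Data.Nat using (ℕ; zero; suc)
open import Data.Nat.Divisibility using (_∣_)
open import Data.Unit using () renaming (⊤ to Unit)
open import Data.Bool using (Bool; true; false)
open import Data.Fin using (Fin)
open import Data.Fin.Subset using (Subset; _∈_; _∪_; _∩_; ⊥; ∣_∣; Nonempty; _⊆_)
open import Data.List using (List; []; _∷_)
open import Data.Vec using (Vec) renaming ([] to []ᵥ; _∷_ to _∷ᵥ_)
open import Data.List.Relation.Unary.All using (All)
open import Data.List.Relation.Unary.Any using (Any)
open import Data.List.Relation.Unary.AllPairs using (AllPairs)
open import Data.Maybe using (Maybe; just; nothing)
open import Data.Product using (Σ; _×_; _,_)
open import Data.Sum using (_⊎_)
open import Data.Empty renaming (⊥ to Empty)
open import Function.Bundles using (_↔_; Inverse)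
open import Relation.Binary.PropositionalEquality using (_≡_; _≢_)
open import Relation.Binary.Construct.Closure.ReflexiveTransitive using (Star)

record Sub (A : Set) (P : A → Set) : Set where
  constructor _,ₛ_
  field
    elt  : A
    .prf : P elt
open Sub public

_HasSize_ : Set → ℕ → Set
A HasSize m = Fin m ↔ A

module Order {A : Set} (_≤_ : A → A → Set) where

  _<_ : A → A → Set
  x < y = x ≤ y × x ≢ y

  _⋖_ : A → A → Set
  x ⋖ y = x < y × (∀ z → x ≤ z → z ≤ y → z ≡ x ⊎ z ≡ y)

  IsMaximal : A → Set
  IsMaximal x = ∀ y → x ≤ y → y ≡ x

  IsUpperBound : (A → Set) → A → Set
  IsUpperBound P x = ∀ y → P y → y ≤ x

  IsLowerBound : (A → Set) → A → Set
  IsLowerBound P x = ∀ y → P y → x ≤ y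

  IsLUB : (A → Set) → A → Set
  IsLUB P x = IsUpperBound P x × (∀ z → IsUpperBound P z → x ≤ z)

  IsGLB : (A → Set) → A → Set
  IsGLB P x = IsLowerBound P x × (∀ z → IsLowerBound P z → z ≤ x)

  IsJoin : A → A → A → Set
  IsJoin x y j = IsLUB (λ w → w ≡ x ⊎ w ≡ y) j

  IsMeet : A → A → A → Set
  IsMeet x y m = IsGLB (λ w → w ≡ x ⊎ w ≡ y) m

  IsLattice : Set
  IsLattice = ∀ x y → Σ A (IsJoin x y) × Σ A (IsMeet x y)

  Semimodular : Set
  Semimodular = ∀ x y m j → IsMeet x y m → IsJoin x y j →
                m ⋖ x → m ⋖ y → (x ⋖ j × y ⋖ j)

  module WithBottom (bot : A) where

    IsAtom : A → Set
    IsAtom a = bot ⋖ a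

    IsAtomic : Set
    IsAtomic = ∀ x → IsLUB (λ a → IsAtom a × a ≤ x) x

    IsRankFunction : (A → ℕ) → Set
    IsRankFunction ρ = (ρ bot ≡ 0) × (∀ x y → x ⋖ y → ρ y ≡ suc (ρ x))

  Interval : A → A → Set
  Interval x y = Sub A (λ z → x ≤ z × z ≤ y)

  _≤ᴵ_ : ∀ {x y} → Interval x y → Interval x y → Set
  u ≤ᴵ v = elt u ≤ elt v

OrderIso : (A : Set) → (A → A → Set) → (B : Set) → (B → B → Set) → Set
OrderIso A _≤A_ B _≤B_ =
  Σ (A ↔ B) λ f → ∀ a b →
    (a ≤A b → Inverse.to f a ≤B Inverse.to f b) ×
    (Inverse.to f a ≤B Inverse.to f b → a ≤A b)

𝓑 : ℕ → Set
𝓑 j = Subset j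

_≤𝓑_ : ∀ {j} → 𝓑 j → 𝓑 j → Set
_≤𝓑_ = _⊆_

module _ {n : ℕ} where

  Disjoint : Subset n → Subset n → Set
  Disjoint A B = A ∩ B ≡ ⊥

  -- (B₁,…,Bₖ) is a d-divisible ordered set partition of [n].
  -- The condition bs ≢ [] only matters for n = 0 and implements the
  -- convention Ω₀ = {0̂}.
  IsDOSP : ℕ → List (Subset n) → Set
  IsDOSP d bs =
    (bs ≢ []) ×
    All Nonempty bs ×
    AllPairs Disjoint bs ×
    (∀ i → Any (i ∈_) bs) ×
    All (λ B → d ∣ ∣ B ∣) bs

  data Merge : List (Subset n) → List (Subset n) → Set where
    here  : ∀ {A B rest} → Merge (A ∷ B ∷ rest) ((A ∪ B) ∷ rest)
    there : ∀ {A xs ys} → Merge xs ys → Merge (A ∷ xs) (A ∷ ys)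

data Ω (n d : ℕ) : Set where
  0̂  : Ω n d
  osp : (bs : List (Subset n)) → .(IsDOSP d bs) → Ω n d

data _≤Ω_ {n d : ℕ} : Ω n d → Ω n d → Set where
  0̂≤   : ∀ {x} → 0̂ ≤Ω x
  osp≤ : ∀ {bs cs} .{p : IsDOSP d bs} .{q : IsDOSP d cs} →
         Star Merge bs cs → osp bs p ≤Ω osp cs q

blocksOf : ∀ {n d} → Ω n d → Maybe (List (Subset n))
blocksOf 0̂         = nothing
blocksOf (osp bs _) = just bs

AllBlocksOfSize : ∀ {n} (d : ℕ) → Ω n d → Set
AllBlocksOfSize d 0̂         = Empty
AllBlocksOfSize d (osp bs _) = All (λ B → ∣ B ∣ ≡ d) bs

IsOSP : ∀ {n d} → Ω n d → Set
IsOSP 0̂        = Empty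
IsOSP (osp _ _) = Unit

-- Unordered set partitions: a set of blocks, i.e. a set of subsets of
-- [n].  Sets of subsets of [n] are represented by a binary trie
-- (Family n ≅ (Subset n → Bool), with extensional equality).

Family : ℕ → Set
Family zero    = Bool
Family (suc n) = Family n × Family n

_∈F_ : ∀ {n} → Subset n → Family n → Set
_∈F_ {zero}  []ᵥ          b       = b ≡ true
_∈F_ {suc n} (false ∷ᵥ s) (f , t) = s ∈F f
_∈F_ {suc n} (true  ∷ᵥ s) (f , t) = s ∈F t

IsDPartition : ∀ {n} → ℕ → ℕ → Family n → Set
IsDPartition {n} d k F =
  (∀ B → B ∈F F → Nonempty B) ×
  (∀ B C → B ∈F F → C ∈F F → B ≢ C → Disjoint B C) ×
  (∀ i → Σ (Subset n) λ B → B ∈F F × i ∈ B) ×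
  (∀ B → B ∈F F → d ∣ ∣ B ∣) ×
  (Sub (Subset n) (_∈F F) HasSize k)

DPartitions : ℕ → ℕ → ℕ → Set
DPartitions n d k = Sub (Family n) (IsDPartition d k)

-- An ordered set partition (B₁,…,Bₖ) is determined by its chain of prefix unions
-- B₁ ⊂ B₁∪B₂ ⊂ ⋯ ⊂ [n], and merging two adjacent blocks deletes one inner element of the chain,
-- so ω ≤ ψ exactly when the chain of ψ is contained in that of ω.  Hence the elements above ω
-- correspond to the subsets of the k − 1 inner elements of its chain (Boolean intervals, rank
-- n/d − k + 1), joins intersect chains, and meets unite them when the union is still a chain
-- (otherwise the meet is 0̂).  The atoms are the partitions into d-sets, and ω is the join of the
-- atoms obtained by cutting each block into d-sets, since the first piece of a block can be made
-- to contain any prescribed point.  An ordered partition with k + 1 blocks is an unordered one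
-- together with an ordering of its blocks, which is encoded by a Lehmer code.

module Submission where

open import Defs
open import Data.Bool as Bool using (Bool; true; false)
open import Data.Empty using (⊥-elim; ⊥-elim-irr)
open import Data.Fin using (Fin; zero; suc; punchIn; punchOut)
import Data.Fin.Properties as Finₚ
open import Data.Fin.Subset
  using (Subset; _∈_; _∉_; _∪_; _∩_; _─_; ⊥; ⊤; ∣_∣; Nonempty; _⊆_; ⁅_⁆)
open import Data.Fin.Subset.Properties
open import Data.List using (List; []; _∷_; length; _++_; foldl; map)
open import Data.Nat.ListAction using (sum)
import Data.List.Relation.Unary.All.Properties as Allₚ
import Data.List.Relation.Unary.AllPairs.Properties as AllPairsₚ
import Data.List.Relation.Unary.Any.Properties as Anyₚ
open import Data.Maybe using (Maybe; just; nothing)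
open import Data.List.Membership.Propositional as Membership using () renaming (_∈_ to _∈ₗ_)
import Data.List.Membership.Propositional.Properties as Membershipₚ
open import Data.List.Relation.Binary.Subset.Propositional using () renaming (_⊆_ to _⊆ₗ_)
open import Data.List.Relation.Unary.All as All using (All; []; _∷_)
open import Data.List.Relation.Unary.AllPairs as AllPairs using (AllPairs; []; _∷_)
open import Data.List.Relation.Unary.Any as Any using (Any; here; there)
open import Data.Nat using (ℕ; zero; suc; _+_; _*_; _∸_; _/_; _!; pred; _<_; _≤_; z≤n; s≤s; NonZero)
open import Data.Nat.DivMod using (m/n*n≡m)
open import Data.Nat.Divisibility using (divides; _∣_; _∣?_; ∣m∣n⇒∣m+n; ∣m+n∣m⇒∣n; ∣-refl; ∣⇒≤)
import Data.Nat.Properties as Nₚ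
open import Data.Nat.Properties
  using (+-suc; +-comm; +-assoc; +-identityʳ; +-mono-≤; +-cancelʳ-≡; *-cancelʳ-≡; *-cancelʳ-≤;
         +-∸-assoc; m∸n+n≡m; m∸[m∸n]≡n; m+n∸n≡m; m+n∸m≡n;
         m≤m+n; n≤1+n; ≤-pred; <-irrefl; ≤-reflexive; ≤-trans; <-trans; <-≤-trans)
open import Data.Product using (Σ; _×_; _,_; proj₁; proj₂; ∃-syntax; uncurry)
open import Function using (_∘_)
open import Function.Definitions using (Injective)
open import Function.Construct.Composition using (_↔-∘_)
open import Function.Construct.Identity using (↔-id)
open import Function.Construct.Symmetry using (↔-sym)
open import Data.Fin.Permutation using (↔⇒≡)
open import Data.Product.Function.NonDependent.Propositional using (_×-↔_)
open import Data.Unit using (tt) renaming (⊤ to Unit)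
open import Data.Sum using (_⊎_; inj₁; inj₂)
import Data.Sum as Sum
open import Data.Vec using (Vec; []; _∷_; here; there)
import Data.Vec as Vec
import Data.Vec.Membership.Propositional.Properties as VecMembershipₚ
import Data.Vec.Relation.Unary.Any as VecAny
import Data.Vec.Relation.Unary.Any.Properties as VecAnyₚ
open import Data.List.Relation.Unary.Unique.Propositional using (Unique)
import Data.List.Relation.Unary.Unique.Propositional.Properties as Uniqueₚ
import Data.Vec.Properties as Vecₚ
import Data.List.Properties as Listₚ
open import Relation.Binary.Construct.Closure.ReflexiveTransitive using (Star; ε; _◅_; _◅◅_; gmap)
open import Relation.Binary.Definitions using (DecidableEquality)
open import Relation.Binary.PropositionalEquality
open import Function.Bundles using (_⇔_; mk⇔; Equivalence; _↔_; mk↔ₛ′)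
open import Relation.Nullary using (¬_; Dec; yes; no; contradiction; ¬?)
open import Relation.Nullary.Decidable using (_×-dec_; recompute; toWitness)

variable
  n : ℕ
  x : Fin n
  p q r : Subset n
  A B C acc : Subset n
  xs ys zs : List (Subset n)


_≟ₛ_ : DecidableEquality (Subset n)
_≟ₛ_ = Vecₚ.≡-dec Bool._≟_

x∈p─q⇒x∉q : ∀ (p q : Subset n) → x ∈ p ─ q → x ∉ q
x∈p─q⇒x∉q (true ∷ p) (false ∷ q) here = λ ()
x∈p─q⇒x∉q (_ ∷ p) (_ ∷ q) (there x∈) (there x∈q) = x∈p─q⇒x∉q p q x∈ x∈q

disjoint⇒∉ : Disjoint p q → x ∈ p → x ∉ q
disjoint⇒∉ p∩q≡⊥ x∈p x∈q = ∉⊥ (subst (_ ∈_) p∩q≡⊥ (x∈p∩q⁺ (x∈p , x∈q)))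

∉⇒disjoint : (∀ {x} → x ∈ p → x ∉ q) → Disjoint p q
∉⇒disjoint {p = p} {q} h = Empty-unique λ (_ , x∈) → let (x∈p , x∈q) = x∈p∩q⁻ p q x∈ in h x∈p x∈q

disjoint-sym : Disjoint p q → Disjoint q p
disjoint-sym {p = p} {q} = trans (∩-comm q p)

disjoint-∪ˡ : Disjoint p r → Disjoint q r → Disjoint (p ∪ q) r
disjoint-∪ˡ {p = p} {r} {q} p∩r≡⊥ q∩r≡⊥ = begin
  (p ∪ q) ∩ r        ≡⟨ ∩-distribʳ-∪ r p q ⟩
  (p ∩ r) ∪ (q ∩ r)  ≡⟨ cong₂ _∪_ p∩r≡⊥ q∩r≡⊥ ⟩
  ⊥ ∪ ⊥              ≡⟨ ∪-identityˡ ⊥ ⟩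
  ⊥                  ∎
  where open ≡-Reasoning

disjoint-∪ʳ : Disjoint p q → Disjoint p r → Disjoint p (q ∪ r)
disjoint-∪ʳ p∩q≡⊥ p∩r≡⊥ = disjoint-sym (disjoint-∪ˡ (disjoint-sym p∩q≡⊥) (disjoint-sym p∩r≡⊥))

disjoint-⊆ˡ : p ⊆ q → Disjoint q r → Disjoint p r
disjoint-⊆ˡ p⊆q q∩r≡⊥ = ∉⇒disjoint λ x∈p → disjoint⇒∉ q∩r≡⊥ (p⊆q x∈p)

disjoint-⊆ʳ : q ⊆ r → Disjoint p r → Disjoint p q
disjoint-⊆ʳ q⊆r p∩r≡⊥ = disjoint-sym (disjoint-⊆ˡ q⊆r (disjoint-sym p∩r≡⊥))

⊥-disjoint : ∀ (p : Subset n) → Disjoint ⊥ p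
⊥-disjoint = ∩-zeroˡ

p─q-disjoint : ∀ (p q : Subset n) → Disjoint (p ─ q) q
p─q-disjoint p q = ∉⇒disjoint (x∈p─q⇒x∉q p q)

∪-⊆-cancelˡ : Disjoint r p → r ∪ p ⊆ r ∪ q → p ⊆ q
∪-⊆-cancelˡ {r = r} {q = q} r#p r∪p⊆r∪q x∈p with x∈p∪q⁻ r q (r∪p⊆r∪q (x∈p∪q⁺ (inj₂ x∈p)))
... | inj₁ x∈r = contradiction x∈p (disjoint⇒∉ r#p x∈r)
... | inj₂ x∈q = x∈q

∪-cancelˡ-disjoint : Disjoint r p → Disjoint r q → r ∪ p ≡ r ∪ q → p ≡ q
∪-cancelˡ-disjoint r#p r#q eq = ⊆-antisym (∪-⊆-cancelˡ r#p (⊆-reflexive eq)) (∪-⊆-cancelˡ r#q (⊆-reflexive (sym eq)))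

p─q∪q≡p : q ⊆ p → (p ─ q) ∪ q ≡ p
p─q∪q≡p {q = q} {p} q⊆p = ⊆-antisym ⊆p p⊆
  where
  ⊆p : (p ─ q) ∪ q ⊆ p
  ⊆p x∈ with x∈p∪q⁻ (p ─ q) q x∈
  ... | inj₁ x∈p─q = p─q⊆p p q x∈p─q
  ... | inj₂ x∈q   = q⊆p x∈q
  p⊆ : p ⊆ (p ─ q) ∪ q
  p⊆ {x} x∈p with x ∈? q
  ... | yes x∈q = x∈p∪q⁺ (inj₂ x∈q)
  ... | no  x∉q = x∈p∪q⁺ (inj₁ (x∈p∧x∉q⇒x∈p─q x∈p x∉q))

⊂⇒nonempty-─ : q ⊆ p → q ≢ p → Nonempty (p ─ q)
⊂⇒nonempty-─ {q = q} {p = p} q⊆p q≢p with nonempty? (p ─ q)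
... | yes nonempty = nonempty
... | no  empty    = contradiction (sym p≡q) q≢p
  where
  open ≡-Reasoning
  p≡q : p ≡ q
  p≡q = begin
    p              ≡⟨ sym (p─q∪q≡p q⊆p) ⟩
    (p ─ q) ∪ q    ≡⟨ cong (_∪ q) (Empty-unique empty) ⟩
    ⊥ ∪ q          ≡⟨ ∪-identityˡ q ⟩
    q              ∎

∣p∪q∣≡∣p∣+∣q∣ : ∀ (p q : Subset n) → Disjoint p q → ∣ p ∪ q ∣ ≡ ∣ p ∣ + ∣ q ∣
∣p∪q∣≡∣p∣+∣q∣ []          []          _  = refl
∣p∪q∣≡∣p∣+∣q∣ (true  ∷ p) (true  ∷ q) ()
∣p∪q∣≡∣p∣+∣q∣ (true  ∷ p) (false ∷ q) eq = cong suc (∣p∪q∣≡∣p∣+∣q∣ p q (Vecₚ.∷-injectiveʳ eq))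
∣p∪q∣≡∣p∣+∣q∣ (false ∷ p) (true  ∷ q) eq =
  trans (cong suc (∣p∪q∣≡∣p∣+∣q∣ p q (Vecₚ.∷-injectiveʳ eq))) (sym (+-suc ∣ p ∣ ∣ q ∣))
∣p∪q∣≡∣p∣+∣q∣ (false ∷ p) (false ∷ q) eq = ∣p∪q∣≡∣p∣+∣q∣ p q (Vecₚ.∷-injectiveʳ eq)

∣p─q∣+∣q∣≡∣p∣ : q ⊆ p → ∣ p ─ q ∣ + ∣ q ∣ ≡ ∣ p ∣
∣p─q∣+∣q∣≡∣p∣ {q = q} {p} q⊆p =
  trans (sym (∣p∪q∣≡∣p∣+∣q∣ (p ─ q) q (p─q-disjoint p q))) (cong ∣_∣ (p─q∪q≡p q⊆p))

nonempty⇒∣p∣>0 : Nonempty p → 0 < ∣ p ∣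
nonempty⇒∣p∣>0 {p = p} (x , x∈p) =
  subst (_≤ ∣ p ∣) (∣⁅x⁆∣≡1 x) (p⊆q⇒∣p∣≤∣q∣ ⁅x⁆⊆p)
  where
  ⁅x⁆⊆p : ⁅ x ⁆ ⊆ p
  ⁅x⁆⊆p y∈ = subst (_∈ p) (sym (x∈⁅y⁆⇒x≡y x y∈)) x∈p

∣p∣>0⇒nonempty : ∀ (p : Subset n) → 0 < ∣ p ∣ → Nonempty p
∣p∣>0⇒nonempty {n} p ∣p∣>0 with nonempty? p
... | yes ne = ne
... | no ¬ne = contradiction (subst (λ s → 0 < ∣ s ∣) (Empty-unique ¬ne) ∣p∣>0) (<-irrefl (sym (∣⊥∣≡0 n)))


isDOSP? : ∀ d (bs : List (Subset n)) → Dec (IsDOSP d bs)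
isDOSP? d bs =
  nonNil? bs ×-dec All.all? nonempty? bs ×-dec AllPairs.allPairs? disjoint? bs
  ×-dec Finₚ.all? (λ i → Any.any? (i ∈?_) bs) ×-dec All.all? (λ B → d ∣? ∣ B ∣) bs
  where
  nonNil? : (bs : List (Subset n)) → Dec (bs ≢ [])
  nonNil? []      = no λ []≢[] → []≢[] refl
  nonNil? (_ ∷ _) = yes λ ()
  disjoint? : (p q : Subset n) → Dec (Disjoint p q)
  disjoint? p q = (p ∩ q) ≟ₛ ⊥

recompute-IsDOSP : ∀ {d} → .(IsDOSP d xs) → IsDOSP d xs
recompute-IsDOSP = recompute (isDOSP? _ _)

Sub-≡ : ∀ {X : Set} {P : X → Set} {u v : Sub X P} → elt u ≡ elt v → u ≡ v
Sub-≡ {u = _ ,ₛ _} {v = _ ,ₛ _} refl = refl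

osp-cong : ∀ {d} .{p : IsDOSP d xs} .{q : IsDOSP d ys} → xs ≡ ys → osp {n} {d} xs p ≡ osp ys q
osp-cong refl = refl

osp-injective : ∀ {d} .{p : IsDOSP d xs} .{q : IsDOSP d ys} → osp {n} {d} xs p ≡ osp ys q → xs ≡ ys
osp-injective refl = refl

infix 4 _⊑_

_⊑_ : List (Subset n) → List (Subset n) → Set
_⊑_ = Star Merge

≤Ω⇒⊑ : ∀ {d} .{p : IsDOSP d xs} .{q : IsDOSP d ys} → osp {n} {d} xs p ≤Ω osp ys q → xs ⊑ ys
≤Ω⇒⊑ (osp≤ xs⊑ys) = xs⊑ys

⊑-∷ : xs ⊑ ys → A ∷ xs ⊑ A ∷ ys
⊑-∷ = gmap _ there

merge-length : Merge xs ys → length xs ≡ suc (length ys)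
merge-length here      = refl
merge-length (there m) = cong suc (merge-length m)

⊑⇒≡⊎length< : xs ⊑ ys → xs ≡ ys ⊎ length ys < length xs
⊑⇒≡⊎length< ε = inj₁ refl
⊑⇒≡⊎length< (m ◅ ms) with ⊑⇒≡⊎length< ms
... | inj₁ refl = inj₂ (≤-reflexive (sym (merge-length m)))
... | inj₂ lt   = inj₂ (<-trans lt (≤-reflexive (sym (merge-length m))))

module _ {P : Subset n → Set} (P-∪ : ∀ {A B} → P A → P B → P (A ∪ B)) where

  merge-All : Merge xs ys → All P xs → All P ys
  merge-All here      (pA ∷ pB ∷ ps) = P-∪ pA pB ∷ ps
  merge-All (there m) (pA ∷ ps)      = pA ∷ merge-All m ps

merge-AllPairs-disjoint : Merge xs ys → AllPairs Disjoint xs → AllPairs Disjoint ys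
merge-AllPairs-disjoint here ((_ ∷ A#) ∷ B# ∷ #s) = All.zipWith (uncurry disjoint-∪ˡ) (A# , B#) ∷ #s
merge-AllPairs-disjoint (there m) (A# ∷ #s) = merge-All disjoint-∪ʳ m A# ∷ merge-AllPairs-disjoint m #s

merge-covers : Merge xs ys → Any (x ∈_) xs → Any (x ∈_) ys
merge-covers here      (here x∈A)         = here (x∈p∪q⁺ (inj₁ x∈A))
merge-covers here      (there (here x∈B)) = here (x∈p∪q⁺ (inj₂ x∈B))
merge-covers here      (there (there x∈)) = there x∈
merge-covers (there m) (here x∈A)         = here x∈A
merge-covers (there m) (there x∈)         = there (merge-covers m x∈)

merge-divisible : ∀ {d} → Merge xs ys → AllPairs Disjoint xs →
                  All (λ B → d ∣ ∣ B ∣) xs → All (λ B → d ∣ ∣ B ∣) ys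
merge-divisible {xs = A ∷ B ∷ _} here ((A#B ∷ _) ∷ _) (d∣A ∷ d∣B ∷ d∣s) =
  subst (_ ∣_) (sym (∣p∪q∣≡∣p∣+∣q∣ A B A#B)) (∣m∣n⇒∣m+n d∣A d∣B) ∷ d∣s
merge-divisible (there m) (_ ∷ #s) (d∣A ∷ d∣s) = d∣A ∷ merge-divisible m #s d∣s

merge-IsDOSP : ∀ {d} → Merge xs ys → IsDOSP d xs → IsDOSP d ys
merge-IsDOSP m (_ , nonempty , disjoint , covers , divisible) =
  nonNil m , merge-All nonempty-∪ m nonempty , merge-AllPairs-disjoint m disjoint ,
  (λ i → merge-covers m (covers i)) , merge-divisible m disjoint divisible
  where
  nonNil : Merge xs ys → ys ≢ []
  nonNil here      ()
  nonNil (there _) ()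
  nonempty-∪ : Nonempty A → Nonempty B → Nonempty (A ∪ B)
  nonempty-∪ (x , x∈A) _ = x , x∈p∪q⁺ (inj₁ x∈A)

⊑-IsDOSP : ∀ {d} → xs ⊑ ys → IsDOSP d xs → IsDOSP d ys
⊑-IsDOSP ε        = λ p → p
⊑-IsDOSP (m ◅ ms) = ⊑-IsDOSP ms ∘ merge-IsDOSP m


disjoint-nonempty⇒unique : AllPairs Disjoint xs → All Nonempty xs → Unique xs
disjoint-nonempty⇒unique []            []                 = []
disjoint-nonempty⇒unique (A#xs ∷ #xs) ((i , i∈A) ∷ nonempty) =
  All.map (λ A#B A≡B → disjoint⇒∉ (subst (Disjoint _) (sym A≡B) A#B) i∈A i∈A) A#xs
  ∷ disjoint-nonempty⇒unique #xs nonempty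


-- Chains of prefix unions

prefixUnions : Subset n → List (Subset n) → List (Subset n)
prefixUnions acc []       = []
prefixUnions acc (B ∷ bs) = (acc ∪ B) ∷ prefixUnions (acc ∪ B) bs

chain : List (Subset n) → List (Subset n)
chain = prefixUnions ⊥

prefixUnions-merge : ∀ (acc A B : Subset n) xs →
  prefixUnions acc (A ∷ B ∷ xs) ≡ (acc ∪ A) ∷ prefixUnions acc ((A ∪ B) ∷ xs)
prefixUnions-merge acc A B xs = cong (λ S → (acc ∪ A) ∷ S ∷ prefixUnions S xs) (∪-assoc acc A B)

merge-prefixUnions : Merge xs ys → prefixUnions acc ys ⊆ₗ prefixUnions acc xs
merge-prefixUnions {xs = A ∷ B ∷ xs} {acc = acc} here {P} P∈ =
  subst (P ∈ₗ_) (sym (prefixUnions-merge acc A B xs)) (there P∈)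
merge-prefixUnions (there m) (here P≡) = here P≡
merge-prefixUnions (there m) (there P∈) = there (merge-prefixUnions m P∈)

⊑⇒prefixUnions⊇ : xs ⊑ ys → prefixUnions acc ys ⊆ₗ prefixUnions acc xs
⊑⇒prefixUnions⊇ ε        = λ P∈ → P∈
⊑⇒prefixUnions⊇ (m ◅ ms) = merge-prefixUnions m ∘ ⊑⇒prefixUnions⊇ ms

prefixUnions-⊇acc : ∀ {P} ys → P ∈ₗ prefixUnions acc ys → acc ⊆ P
prefixUnions-⊇acc (B ∷ ys) (here refl) = λ x∈ → x∈p∪q⁺ (inj₁ x∈)
prefixUnions-⊇acc (B ∷ ys) (there P∈)  = prefixUnions-⊇acc ys P∈ ∘ (λ x∈ → x∈p∪q⁺ (inj₁ x∈))

prefixUnions-⊇head : ∀ {P} ys → P ∈ₗ prefixUnions acc (B ∷ ys) → acc ∪ B ⊆ P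
prefixUnions-⊇head ys (here refl) = λ x∈ → x∈
prefixUnions-⊇head ys (there P∈)  = prefixUnions-⊇acc ys P∈

prefixUnions-isChain : ∀ (acc : Subset n) zs {P Q} →
                       P ∈ₗ prefixUnions acc zs → Q ∈ₗ prefixUnions acc zs → P ⊆ Q ⊎ Q ⊆ P
prefixUnions-isChain acc (Z ∷ zs) (here refl) (here refl) = inj₁ ⊆-refl
prefixUnions-isChain acc (Z ∷ zs) (here refl) (there Q∈)  = inj₁ (prefixUnions-⊇acc zs Q∈)
prefixUnions-isChain acc (Z ∷ zs) (there P∈)  (here refl) = inj₂ (prefixUnions-⊇acc zs P∈)
prefixUnions-isChain acc (Z ∷ zs) (there P∈)  (there Q∈)  = prefixUnions-isChain (acc ∪ Z) zs P∈ Q∈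

prefixUnions-─ : ∀ (acc : Subset n) ys → A ⊆ B → prefixUnions (acc ∪ A) ((B ─ A) ∷ ys) ≡ prefixUnions acc (B ∷ ys)
prefixUnions-─ {A = A} {B = B} acc ys A⊆B = cong (λ S → S ∷ prefixUnions S ys) (begin
  (acc ∪ A) ∪ (B ─ A)   ≡⟨ ∪-assoc acc A (B ─ A) ⟩
  acc ∪ (A ∪ (B ─ A))   ≡⟨ cong (acc ∪_) (∪-comm A (B ─ A)) ⟩
  acc ∪ ((B ─ A) ∪ A)   ≡⟨ cong (acc ∪_) (p─q∪q≡p A⊆B) ⟩
  acc ∪ B               ∎)
  where open ≡-Reasoning

FreshBlocks : Subset n → List (Subset n) → Set
FreshBlocks acc bs = AllPairs Disjoint (acc ∷ bs) × All Nonempty bs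

Covers : Subset n → List (Subset n) → Set
Covers acc bs = ∀ i → i ∈ acc ⊎ Any (i ∈_) bs

disjoint-∪-head : AllPairs Disjoint (acc ∷ A ∷ xs) → AllPairs Disjoint ((acc ∪ A) ∷ xs)
disjoint-∪-head ((_ ∷ acc#xs) ∷ A#xs ∷ #s) = All.zipWith (uncurry disjoint-∪ˡ) (acc#xs , A#xs) ∷ #s

freshBlocks-∷⁻ : FreshBlocks acc (A ∷ xs) → FreshBlocks (acc ∪ A) xs
freshBlocks-∷⁻ (disjoint , _ ∷ nonempty) = disjoint-∪-head disjoint , nonempty

freshBlocks-merge : FreshBlocks acc (A ∷ B ∷ xs) → FreshBlocks acc ((A ∪ B) ∷ xs)
freshBlocks-merge ((acc#A ∷ acc#B ∷ acc#xs) ∷ (A#B ∷ A#xs) ∷ B#xs ∷ #s , (x , x∈A) ∷ _ ∷ nonempty) =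
  (disjoint-∪ʳ acc#A acc#B ∷ acc#xs) ∷ All.zipWith (uncurry disjoint-∪ˡ) (A#xs , B#xs) ∷ #s ,
  (x , x∈p∪q⁺ (inj₁ x∈A)) ∷ nonempty

covers-∷⁻ : Covers acc (A ∷ xs) → Covers (acc ∪ A) xs
covers-∷⁻ cov i with cov i
... | inj₁ i∈acc          = inj₁ (x∈p∪q⁺ (inj₁ i∈acc))
... | inj₂ (here i∈A)     = inj₁ (x∈p∪q⁺ (inj₂ i∈A))
... | inj₂ (there i∈xs)   = inj₂ i∈xs

prefixUnions-fresh : ∀ {P} ys → FreshBlocks acc ys → P ∈ₗ prefixUnions acc ys → ∃[ i ] i ∈ P × i ∉ acc
prefixUnions-fresh (B ∷ ys) ((acc#B ∷ _) ∷ _ , (i , i∈B) ∷ _) P∈ =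
  i , prefixUnions-⊇head ys P∈ (x∈p∪q⁺ (inj₂ i∈B)) , λ i∈acc → disjoint⇒∉ acc#B i∈acc i∈B

mutual
  prefixUnions⊆⇒⊑ : FreshBlocks acc xs → FreshBlocks acc ys → Covers acc ys →
                    prefixUnions acc ys ⊆ₗ prefixUnions acc xs → xs ⊑ ys
  prefixUnions⊆⇒⊑ {xs = []}     {ys = []}    _ _ _ _ = ε
  prefixUnions⊆⇒⊑ {xs = []}     {ys = _ ∷ _} _ _ _ ys⊆xs with ys⊆xs (here refl)
  ... | ()
  prefixUnions⊆⇒⊑ {xs = A ∷ xs} fx fy cov ys⊆xs = ∷-prefixUnions⊆⇒⊑ fx fy cov ys⊆xs

  ∷-prefixUnions⊆⇒⊑ : FreshBlocks acc (A ∷ xs) → FreshBlocks acc ys → Covers acc ys →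
                      prefixUnions acc ys ⊆ₗ prefixUnions acc (A ∷ xs) → A ∷ xs ⊑ ys
  ∷-prefixUnions⊆⇒⊑ {ys = []} ((acc#A ∷ _) ∷ _ , (i , i∈A) ∷ _) _ cov _ with cov i
  ... | inj₁ i∈acc = contradiction i∈A (disjoint⇒∉ acc#A i∈acc)
  ... | inj₂ ()
  ∷-prefixUnions⊆⇒⊑ {acc = acc} {A = A} {xs = xs} {ys = B ∷ ys} fx fy cov ys⊆xs with ys⊆xs (here refl)
  ... | here acc∪B≡acc∪A = subst (λ S → A ∷ xs ⊑ S ∷ ys) A≡B (⊑-∷ tails⊑)
    where
    A≡B : A ≡ B
    A≡B = ∪-cancelˡ-disjoint (All.head (AllPairs.head (proj₁ fx))) (All.head (AllPairs.head (proj₁ fy)))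
                             (sym acc∪B≡acc∪A)
    fy′ : FreshBlocks (acc ∪ A) ys
    fy′ = subst (λ S → FreshBlocks (acc ∪ S) ys) (sym A≡B) (freshBlocks-∷⁻ fy)
    tails⊆ : prefixUnions (acc ∪ A) ys ⊆ₗ prefixUnions (acc ∪ A) xs
    tails⊆ {P} P∈ with ys⊆xs (there (subst (λ S → P ∈ₗ prefixUnions (acc ∪ S) ys) A≡B P∈))
    ... | here refl = let (i , i∈P , i∉P) = prefixUnions-fresh ys fy′ P∈ in contradiction i∈P i∉P
    ... | there P∈xs = P∈xs
    tails⊑ : xs ⊑ ys
    tails⊑ = prefixUnions⊆⇒⊑ (freshBlocks-∷⁻ fx) fy′
               (subst (λ S → Covers (acc ∪ S) ys) (sym A≡B) (covers-∷⁻ cov)) tails⊆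
  ... | there acc∪B∈ with xs
  ...   | A′ ∷ xs′ = here ◅ ∷-prefixUnions⊆⇒⊑ (freshBlocks-merge fx) fy cov merged⊆
    where
    merged⊆ : prefixUnions acc (B ∷ ys) ⊆ₗ prefixUnions acc ((A ∪ A′) ∷ xs′)
    merged⊆ {P} P∈ with subst (P ∈ₗ_) (prefixUnions-merge acc A A′ xs′) (ys⊆xs P∈)
    ... | here refl =
      let (i , i∈acc∪B , i∉acc∪A) = prefixUnions-fresh (A′ ∷ xs′) (freshBlocks-∷⁻ fx) acc∪B∈
      in contradiction (prefixUnions-⊇head ys P∈ i∈acc∪B) i∉acc∪A
    ... | there P∈merged = P∈merged

chain⊆⇒⊑ : ∀ {d} → IsDOSP d xs → IsDOSP d ys → chain ys ⊆ₗ chain xs → xs ⊑ ys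
chain⊆⇒⊑ {xs = xs} {ys = ys} (_ , nonemptyx , disjointx , _ , _) (_ , nonemptyy , disjointy , coversy , _) =
  prefixUnions⊆⇒⊑ (All.tabulate (λ {B} _ → ⊥-disjoint B) ∷ disjointx , nonemptyx)
                  (All.tabulate (λ {B} _ → ⊥-disjoint B) ∷ disjointy , nonemptyy)
                  (λ i → inj₂ (coversy i))


-- Refining a partition into blocks of size d

∈-foldl-∪⁻ : ∀ (acc : Subset n) cs → x ∈ foldl _∪_ acc cs → x ∈ acc ⊎ Any (x ∈_) cs
∈-foldl-∪⁻ acc []       x∈ = inj₁ x∈
∈-foldl-∪⁻ acc (c ∷ cs) x∈ with ∈-foldl-∪⁻ (acc ∪ c) cs x∈
... | inj₂ x∈cs = inj₂ (there x∈cs)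
... | inj₁ x∈acc∪c with x∈p∪q⁻ acc c x∈acc∪c
...   | inj₁ x∈acc = inj₁ x∈acc
...   | inj₂ x∈c   = inj₂ (here x∈c)

∈-foldl-∪⁺ˡ : ∀ (acc : Subset n) cs → x ∈ acc → x ∈ foldl _∪_ acc cs
∈-foldl-∪⁺ˡ acc []       x∈ = x∈
∈-foldl-∪⁺ˡ acc (c ∷ cs) x∈ = ∈-foldl-∪⁺ˡ (acc ∪ c) cs (x∈p∪q⁺ (inj₁ x∈))

∈-foldl-∪⁺ʳ : ∀ (acc : Subset n) cs → Any (x ∈_) cs → x ∈ foldl _∪_ acc cs
∈-foldl-∪⁺ʳ acc (c ∷ cs) (here x∈c)   = ∈-foldl-∪⁺ˡ (acc ∪ c) cs (x∈p∪q⁺ (inj₂ x∈c))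
∈-foldl-∪⁺ʳ acc (c ∷ cs) (there x∈cs) = ∈-foldl-∪⁺ʳ (acc ∪ c) cs x∈cs

prefixUnions-++ : ∀ (acc : Subset n) cs bs →
  prefixUnions acc (cs ++ bs) ≡ prefixUnions acc cs ++ prefixUnions (foldl _∪_ acc cs) bs
prefixUnions-++ acc []       bs = refl
prefixUnions-++ acc (c ∷ cs) bs = cong ((acc ∪ c) ∷_) (prefixUnions-++ (acc ∪ c) cs bs)

prefixUnions-⊆foldl : ∀ {P} (acc : Subset n) cs → P ∈ₗ prefixUnions acc cs → P ⊆ foldl _∪_ acc cs
prefixUnions-⊆foldl acc (c ∷ cs) (here refl) = ∈-foldl-∪⁺ˡ (acc ∪ c) cs
prefixUnions-⊆foldl acc (c ∷ cs) (there P∈) = prefixUnions-⊆foldl (acc ∪ c) cs P∈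

⊑-foldl-∪ : ∀ (c : Subset n) cs bs → c ∷ cs ++ bs ⊑ foldl _∪_ c cs ∷ bs
⊑-foldl-∪ c []        bs = ε
⊑-foldl-∪ c (c′ ∷ cs) bs = here ◅ ⊑-foldl-∪ (c ∪ c′) cs bs

takeFirst : ℕ → Subset n → Subset n
takeFirst zero    _           = ⊥
takeFirst (suc k) []          = []
takeFirst (suc k) (true ∷ B)  = true ∷ takeFirst k B
takeFirst (suc k) (false ∷ B) = false ∷ takeFirst (suc k) B

takeFirst-⊆ : ∀ k (B : Subset n) → takeFirst k B ⊆ B
takeFirst-⊆ zero    B           = ⊥⊆
takeFirst-⊆ (suc k) (true ∷ B)  here       = here
takeFirst-⊆ (suc k) (true ∷ B)  (there x∈) = there (takeFirst-⊆ k B x∈)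
takeFirst-⊆ (suc k) (false ∷ B) (there x∈) = there (takeFirst-⊆ (suc k) B x∈)

∣takeFirst∣ : ∀ k (B : Subset n) → k ≤ ∣ B ∣ → ∣ takeFirst k B ∣ ≡ k
∣takeFirst∣ {n} zero B _ = ∣⊥∣≡0 n
∣takeFirst∣ (suc k) (true ∷ B)  (s≤s k≤)  = cong suc (∣takeFirst∣ k B k≤)
∣takeFirst∣ (suc k) (false ∷ B) k≤       = ∣takeFirst∣ (suc k) B k≤

module Chunks (d′ : ℕ) where

  private
    d : ℕ
    d = suc d′

  record Chunking (B : Subset n) (cs : List (Subset n)) : Set where
    field
      sizes    : All (λ c → ∣ c ∣ ≡ d) cs
      ⊆block   : All (_⊆ B) cs
      disjoint : AllPairs Disjoint cs
      covers   : ∀ {x} → x ∈ B → Any (x ∈_) cs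

  open Chunking public

  mutual
    chunksOf : ℕ → Subset n → List (Subset n)
    chunksOf zero    B = []
    chunksOf (suc t) B = chunksStartingWith (takeFirst d B) t B

    chunksStartingWith : Subset n → ℕ → Subset n → List (Subset n)
    chunksStartingWith C t B = C ∷ chunksOf t (B ─ C)

  mutual
    chunksOf-Chunking : ∀ t (B : Subset n) → ∣ B ∣ ≡ t * d → Chunking B (chunksOf t B)
    chunksOf-Chunking zero B ∣B∣≡0 = record
      { sizes = [] ; ⊆block = [] ; disjoint = []
      ; covers = λ x∈B → contradiction (subst (_ ∈_) B≡⊥ x∈B) ∉⊥ }
      where
      B≡⊥ : B ≡ ⊥
      B≡⊥ = Empty-unique (<-irrefl (sym ∣B∣≡0) ∘ nonempty⇒∣p∣>0)
    chunksOf-Chunking (suc t) B ∣B∣≡ =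
      chunksStartingWith-Chunking t (takeFirst-⊆ d B)
        (∣takeFirst∣ d B (subst (d ≤_) (sym ∣B∣≡) (m≤m+n d (t * d)))) ∣B∣≡

    chunksStartingWith-Chunking : ∀ t → C ⊆ B → ∣ C ∣ ≡ d → ∣ B ∣ ≡ suc t * d →
                                  Chunking B (chunksStartingWith C t B)
    chunksStartingWith-Chunking {C = C} {B = B} t C⊆B ∣C∣≡d ∣B∣≡ = record
      { sizes    = ∣C∣≡d ∷ sizes rest
      ; ⊆block   = C⊆B ∷ All.map (λ c⊆ {_} x∈ → p─q⊆p B C (c⊆ x∈)) (⊆block rest)
      ; disjoint = All.map (λ {c} (c⊆ : c ⊆ B ─ C) → disjoint-sym (disjoint-⊆ˡ c⊆ (p─q-disjoint B C))) (⊆block rest)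
                   ∷ disjoint rest
      ; covers   = covers′
      }
      where
      ∣B─C∣≡ : ∣ B ─ C ∣ ≡ t * d
      ∣B─C∣≡ = +-cancelʳ-≡ d _ _ (begin
        ∣ B ─ C ∣ + d       ≡⟨ cong (∣ B ─ C ∣ +_) (sym ∣C∣≡d) ⟩
        ∣ B ─ C ∣ + ∣ C ∣   ≡⟨ ∣p─q∣+∣q∣≡∣p∣ C⊆B ⟩
        ∣ B ∣               ≡⟨ ∣B∣≡ ⟩
        d + t * d           ≡⟨ +-comm d (t * d) ⟩
        t * d + d           ∎)
        where open ≡-Reasoning
      rest : Chunking (B ─ C) (chunksOf t (B ─ C))
      rest = chunksOf-Chunking t (B ─ C) ∣B─C∣≡
      covers′ : ∀ {x} → x ∈ B → Any (x ∈_) (chunksStartingWith C t B)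
      covers′ {x} x∈B with x ∈? C
      ... | yes x∈C = here x∈C
      ... | no  x∉C = there (covers rest (x∈p∧x∉q⇒x∈p─q x∈B x∉C))

  chunkAround : Fin n → Subset n → Subset n
  chunkAround i B = ⁅ i ⁆ ∪ takeFirst d′ (B ─ ⁅ i ⁆)

  chunkAround-⊆ : ∀ {i} → i ∈ B → chunkAround i B ⊆ B
  chunkAround-⊆ {B = B} {i} i∈B x∈ with x∈p∪q⁻ ⁅ i ⁆ _ x∈
  ... | inj₁ x∈⁅i⁆ = subst (_∈ B) (sym (x∈⁅y⁆⇒x≡y i x∈⁅i⁆)) i∈B
  ... | inj₂ x∈T   = p─q⊆p B ⁅ i ⁆ (takeFirst-⊆ d′ (B ─ ⁅ i ⁆) x∈T)

  ∣chunkAround∣ : ∀ {i} → i ∈ B → d ≤ ∣ B ∣ → ∣ chunkAround i B ∣ ≡ d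
  ∣chunkAround∣ {n} {B = B} {i} i∈B d≤∣B∣ = begin
    ∣ ⁅ i ⁆ ∪ T ∣       ≡⟨ ∣p∪q∣≡∣p∣+∣q∣ ⁅ i ⁆ T i#T ⟩
    ∣ ⁅ i ⁆ ∣ + ∣ T ∣   ≡⟨ cong₂ _+_ (∣⁅x⁆∣≡1 i) (∣takeFirst∣ d′ (B ─ ⁅ i ⁆) d′≤) ⟩
    d                   ∎
    where
    open ≡-Reasoning
    T : Subset n
    T = takeFirst d′ (B ─ ⁅ i ⁆)
    i#T : Disjoint ⁅ i ⁆ T
    i#T = disjoint-sym (disjoint-⊆ˡ (takeFirst-⊆ d′ _) (p─q-disjoint B ⁅ i ⁆))
    ∣B─i∣+1≡∣B∣ : ∣ B ─ ⁅ i ⁆ ∣ + 1 ≡ ∣ B ∣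
    ∣B─i∣+1≡∣B∣ = trans (cong (∣ B ─ ⁅ i ⁆ ∣ +_) (sym (∣⁅x⁆∣≡1 i)))
                        (∣p─q∣+∣q∣≡∣p∣ λ x∈⁅i⁆ → subst (_∈ B) (sym (x∈⁅y⁆⇒x≡y i x∈⁅i⁆)) i∈B)
    d′≤ : d′ ≤ ∣ B ─ ⁅ i ⁆ ∣
    d′≤ = ≤-pred (subst (d ≤_) (trans (sym ∣B─i∣+1≡∣B∣) (+-comm _ 1)) d≤∣B∣)

  -- The first chunk of a block may be chosen to contain a prescribed element;
  -- this is what makes Ω atomic.
  firstChunk : Maybe (Fin n) → Subset n → Subset n
  firstChunk nothing  B = takeFirst d B
  firstChunk (just i) B with i ∈? B
  ... | yes _ = chunkAround i B
  ... | no  _ = takeFirst d B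

  firstChunk-⊆ : ∀ j (B : Subset n) → firstChunk j B ⊆ B
  firstChunk-⊆ nothing  B = takeFirst-⊆ d B
  firstChunk-⊆ (just i) B with i ∈? B
  ... | yes i∈B = chunkAround-⊆ i∈B
  ... | no  _   = takeFirst-⊆ d B

  ∣firstChunk∣ : ∀ j (B : Subset n) → d ≤ ∣ B ∣ → ∣ firstChunk j B ∣ ≡ d
  ∣firstChunk∣ nothing  B d≤ = ∣takeFirst∣ d B d≤
  ∣firstChunk∣ (just i) B d≤ with i ∈? B
  ... | yes i∈B = ∣chunkAround∣ i∈B d≤
  ... | no  _   = ∣takeFirst∣ d B d≤

  ∈firstChunk : ∀ {i} → i ∈ B → i ∈ firstChunk (just i) B
  ∈firstChunk {B = B} {i} i∈B with i ∈? B
  ... | yes _   = x∈p∪q⁺ (inj₁ (x∈⁅x⁆ i))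
  ... | no i∉B = contradiction i∈B i∉B

  blockChunks : Maybe (Fin n) → Subset n → List (Subset n)
  blockChunks j B = chunksStartingWith (firstChunk j B) (∣ B ∣ / d ∸ 1) B

  Chunkable : Subset n → Set
  Chunkable B = d ∣ ∣ B ∣ × Nonempty B

  blockChunks-Chunking : ∀ j → Chunkable B → Chunking B (blockChunks j B)
  blockChunks-Chunking {B = B} j (d∣∣B∣ , nonempty) =
    chunksStartingWith-Chunking _ (firstChunk-⊆ j B) (∣firstChunk∣ j B (subst (d ≤_) (sym ∣B∣≡) (m≤m+n d _))) ∣B∣≡
    where
    ∣B∣≡ : ∣ B ∣ ≡ suc (∣ B ∣ / d ∸ 1) * d
    ∣B∣≡ with ∣ B ∣ / d | m/n*n≡m {∣ B ∣} {d} d∣∣B∣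
    ... | zero  | 0≡∣B∣ = contradiction (nonempty⇒∣p∣>0 nonempty) (<-irrefl 0≡∣B∣)
    ... | suc _ | eq   = sym eq

  foldl-∪-Chunking : ∀ (acc : Subset n) {cs} → Chunking B cs → foldl _∪_ acc cs ≡ acc ∪ B
  foldl-∪-Chunking {B = B} acc {cs} ch = ⊆-antisym ⊆acc∪B acc∪B⊆
    where
    ⊆acc∪B : foldl _∪_ acc cs ⊆ acc ∪ B
    ⊆acc∪B x∈ with ∈-foldl-∪⁻ acc cs x∈
    ... | inj₁ x∈acc = x∈p∪q⁺ (inj₁ x∈acc)
    ... | inj₂ x∈cs  = let (c⊆B , x∈c) = All.lookupAny (⊆block ch) x∈cs in x∈p∪q⁺ (inj₂ (c⊆B x∈c))
    acc∪B⊆ : acc ∪ B ⊆ foldl _∪_ acc cs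
    acc∪B⊆ x∈ with x∈p∪q⁻ acc B x∈
    ... | inj₁ x∈acc = ∈-foldl-∪⁺ˡ acc cs x∈acc
    ... | inj₂ x∈B   = ∈-foldl-∪⁺ʳ acc cs (covers ch x∈B)

  refine : Maybe (Fin n) → List (Subset n) → List (Subset n)
  refine j []       = []
  refine j (B ∷ bs) = blockChunks j B ++ refine j bs

  module _ (j : Maybe (Fin n)) where

    refine-sizes : All Chunkable xs → All (λ c → ∣ c ∣ ≡ d) (refine j xs)
    refine-sizes []           = []
    refine-sizes (cB ∷ cbs) = Allₚ.++⁺ (sizes (blockChunks-Chunking j cB)) (refine-sizes cbs)

    refine-All-disjoint : All Chunkable xs → All (Disjoint C) xs → All (Disjoint C) (refine j xs)
    refine-All-disjoint []          []            = []
    refine-All-disjoint (cB ∷ cbs) (C#B ∷ C#xs) =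
      Allₚ.++⁺ (All.map (λ {c} (c⊆B : c ⊆ _) → disjoint-⊆ʳ c⊆B C#B) (⊆block (blockChunks-Chunking j cB)))
               (refine-All-disjoint cbs C#xs)

    refine-disjoint : All Chunkable xs → AllPairs Disjoint xs → AllPairs Disjoint (refine j xs)
    refine-disjoint []          []            = []
    refine-disjoint {xs = B ∷ _} (cB ∷ cbs) (B#xs ∷ #xs) =
      AllPairsₚ.++⁺ (disjoint ch) (refine-disjoint cbs #xs)
        (All.map (λ {c} (c⊆B : c ⊆ _) → All.map (disjoint-⊆ˡ c⊆B) (refine-All-disjoint cbs B#xs)) (⊆block ch))
      where
      ch : Chunking B (blockChunks j B)
      ch = blockChunks-Chunking j cB

    refine-covers : All Chunkable xs → Any (x ∈_) xs → Any (x ∈_) (refine j xs)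
    refine-covers (cB ∷ _)   (here x∈B)   = Anyₚ.++⁺ˡ (covers (blockChunks-Chunking j cB) x∈B)
    refine-covers {xs = B ∷ _} (_ ∷ cbs) (there x∈xs) = Anyₚ.++⁺ʳ (blockChunks j B) (refine-covers cbs x∈xs)

    refine-⊑ : All Chunkable xs → refine j xs ⊑ xs
    refine-⊑ [] = ε
    refine-⊑ {xs = B ∷ xs} (cB ∷ cbs) =
      subst (λ S → blockChunks j B ++ refine j xs ⊑ S ∷ refine j xs) ⋃chunks≡B (⊑-foldl-∪ c cs _)
      ◅◅ ⊑-∷ (refine-⊑ cbs)
      where
      c : Subset n
      c = firstChunk j B
      cs : List (Subset n)
      cs = chunksOf (∣ B ∣ / d ∸ 1) (B ─ c)
      ⋃chunks≡B : foldl _∪_ c cs ≡ B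
      ⋃chunks≡B = trans (cong (λ S → foldl _∪_ S cs) (sym (∪-identityˡ c)))
                        (trans (foldl-∪-Chunking ⊥ (blockChunks-Chunking j cB)) (∪-identityˡ B))

  IsDOSP⇒Chunkable : IsDOSP d xs → All Chunkable xs
  IsDOSP⇒Chunkable (_ , nonempty , _ , _ , divisible) = All.zipWith (λ p → p) (divisible , nonempty)

  refine-IsDOSP : ∀ j → IsDOSP d xs → IsDOSP d (refine j xs)
  refine-IsDOSP {xs = []} j (nonNil , _) = contradiction refl nonNil
  refine-IsDOSP {xs = B ∷ xs} j isDOSP@(_ , _ , disjoint , covers , _) =
    (λ ()) ,
    All.map (λ ∣c∣≡d → ∣p∣>0⇒nonempty _ (subst (0 <_) (sym ∣c∣≡d) (s≤s z≤n))) sizes′ ,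
    refine-disjoint j chunkable disjoint ,
    (λ i → refine-covers j chunkable (covers i)) ,
    All.map (λ ∣c∣≡d → subst (d ∣_) (sym ∣c∣≡d) ∣-refl) sizes′
    where
    chunkable : All Chunkable (B ∷ xs)
    chunkable = IsDOSP⇒Chunkable isDOSP
    sizes′ : All (λ c → ∣ c ∣ ≡ d) (refine j (B ∷ xs))
    sizes′ = refine-sizes j chunkable

  -- A block A ⊈ P is excluded by the refinement whose first chunk of A contains a point outside P.
  prefixUnions-refine⁻ : ∀ {P} (acc : Subset n) xs → All Chunkable xs →
                         (∀ j → P ∈ₗ prefixUnions acc (refine j xs)) → P ∈ₗ prefixUnions acc xs
  prefixUnions-refine⁻ acc []       []         P∈ = P∈ nothing
  prefixUnions-refine⁻ {P = P} acc (A ∷ xs) (cA ∷ cxs) P∈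
    with Finₚ.any? (λ i → i ∈? A ×-dec ¬? (i ∈? P))
  ... | yes (i , i∈A , i∉P) =
    contradiction (prefixUnions-⊇head _ (P∈ (just i)) (x∈p∪q⁺ (inj₂ (∈firstChunk i∈A)))) i∉P
  ... | no ∄ with P ≟ₛ (acc ∪ A)
  ...   | yes refl  = here refl
  ...   | no  P≢acc∪A = there (prefixUnions-refine⁻ (acc ∪ A) xs cxs P∈tail)
    where
    A⊆P : A ⊆ P
    A⊆P {x} x∈A with x ∈? P
    ... | yes x∈P = x∈P
    ... | no  x∉P = contradiction (x , x∈A , x∉P) ∄
    P∈tail : ∀ j → P ∈ₗ prefixUnions (acc ∪ A) (refine j xs)
    P∈tail j with Membershipₚ.∈-++⁻ (prefixUnions acc (blockChunks j A))
                    (subst (P ∈ₗ_) (prefixUnions-++ acc (blockChunks j A) (refine j xs)) (P∈ j))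
    ... | inj₁ P∈chunks = contradiction (⊆-antisym P⊆acc∪A acc∪A⊆P) P≢acc∪A
      where
      P⊆acc∪A : P ⊆ acc ∪ A
      P⊆acc∪A = subst (P ⊆_) (foldl-∪-Chunking acc (blockChunks-Chunking j cA))
                      (prefixUnions-⊆foldl acc (blockChunks j A) P∈chunks)
      acc∪A⊆P : acc ∪ A ⊆ P
      acc∪A⊆P x∈ with x∈p∪q⁻ acc A x∈
      ... | inj₁ x∈acc = prefixUnions-⊇acc (blockChunks j A) P∈chunks x∈acc
      ... | inj₂ x∈A   = A⊆P x∈A
    ... | inj₂ P∈rest = subst (λ S → P ∈ₗ prefixUnions S (refine j xs))
                              (foldl-∪-Chunking acc (blockChunks-Chunking j cA)) P∈rest


∣foldl-∪∣ : ∀ (acc : Subset n) bs → AllPairs Disjoint (acc ∷ bs) →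
            ∣ foldl _∪_ acc bs ∣ ≡ ∣ acc ∣ + sum (map ∣_∣ bs)
∣foldl-∪∣ acc []       _ = sym (+-identityʳ ∣ acc ∣)
∣foldl-∪∣ acc (B ∷ bs) disjoint@((acc#B ∷ _) ∷ _) = begin
  ∣ foldl _∪_ (acc ∪ B) bs ∣                ≡⟨ ∣foldl-∪∣ (acc ∪ B) bs (disjoint-∪-head disjoint) ⟩
  ∣ acc ∪ B ∣ + sum (map ∣_∣ bs)            ≡⟨ cong (_+ sum (map ∣_∣ bs)) (∣p∪q∣≡∣p∣+∣q∣ acc B acc#B) ⟩
  ∣ acc ∣ + ∣ B ∣ + sum (map ∣_∣ bs)        ≡⟨ +-assoc ∣ acc ∣ ∣ B ∣ _ ⟩
  ∣ acc ∣ + (∣ B ∣ + sum (map ∣_∣ bs))      ∎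
  where open ≡-Reasoning

foldl-∪-⊤ : ∀ (acc : Subset n) bs → (∀ i → Any (i ∈_) bs) → foldl _∪_ acc bs ≡ ⊤
foldl-∪-⊤ acc bs covers = ⊆-antisym ⊆⊤ λ {i} _ → ∈-foldl-∪⁺ʳ acc bs (covers i)

IsDOSP⇒sum≡n : ∀ {n d} {xs : List (Subset n)} → IsDOSP d xs → sum (map ∣_∣ xs) ≡ n
IsDOSP⇒sum≡n {n} {xs = xs} (_ , _ , disjoint , covers , _) = begin
  sum (map ∣_∣ xs)                  ≡⟨ cong (_+ sum (map ∣_∣ xs)) (sym (∣⊥∣≡0 n)) ⟩
  ∣ ⊥ {n} ∣ + sum (map ∣_∣ xs)      ≡⟨ sym (∣foldl-∪∣ ⊥ xs (All.tabulate (λ _ → ⊥-disjoint _) ∷ disjoint)) ⟩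
  ∣ foldl _∪_ ⊥ xs ∣                ≡⟨ cong ∣_∣ (foldl-∪-⊤ ⊥ xs covers) ⟩
  ∣ ⊤ {n} ∣                         ≡⟨ ∣⊤∣≡n n ⟩
  n                                 ∎
  where open ≡-Reasoning

length*d≤sum : ∀ {d} → All (λ B → d ≤ ∣ B ∣) xs → length xs * d ≤ sum (map ∣_∣ xs)
length*d≤sum []             = z≤n
length*d≤sum (d≤∣B∣ ∷ d≤s) = +-mono-≤ d≤∣B∣ (length*d≤sum d≤s)

length*d≡sum : ∀ {d} → All (λ B → ∣ B ∣ ≡ d) xs → length xs * d ≡ sum (map ∣_∣ xs)
length*d≡sum []             = refl
length*d≡sum (∣B∣≡d ∷ ≡s) = cong₂ _+_ (sym ∣B∣≡d) (length*d≡sum ≡s)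

[a∸l]∸[a∸[l+r]]≡r : ∀ a l r → l + r ≤ a → (a ∸ l) ∸ (a ∸ (l + r)) ≡ r
[a∸l]∸[a∸[l+r]]≡r a l r l+r≤a = begin
  (a ∸ l) ∸ k               ≡⟨ cong (λ a → (a ∸ l) ∸ k) a≡l+[k+r] ⟩
  (l + (k + r) ∸ l) ∸ k     ≡⟨ cong (_∸ k) (m+n∸m≡n l (k + r)) ⟩
  (k + r) ∸ k               ≡⟨ m+n∸m≡n k r ⟩
  r                         ∎
  where
  open ≡-Reasoning
  k : ℕ
  k = a ∸ (l + r)
  a≡l+[k+r] : a ≡ l + (k + r)
  a≡l+[k+r] = begin
    a               ≡⟨ sym (m∸n+n≡m l+r≤a) ⟩
    k + (l + r)     ≡⟨ +-comm k (l + r) ⟩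
    (l + r) + k     ≡⟨ +-assoc l r k ⟩
    l + (r + k)     ≡⟨ cong (l +_) (+-comm r k) ⟩
    l + (k + r)     ∎

≤Ω-refl : ∀ {n d} (x : Ω n d) → x ≤Ω x
≤Ω-refl 0̂         = 0̂≤
≤Ω-refl (osp _ _) = osp≤ ε


-- Coarsenings of a fixed partition

-- coarsen A bs c merges the (i+1)-st block of A ∷ bs into its predecessor exactly when i ∈ c.
coarsen : Subset n → (bs : List (Subset n)) → Subset (length bs) → List (Subset n)
coarsen acc []       []          = acc ∷ []
coarsen acc (B ∷ bs) (true  ∷ c) = coarsen (acc ∪ B) bs c
coarsen acc (B ∷ bs) (false ∷ c) = acc ∷ coarsen B bs c

mergedGaps : Subset n → (bs : List (Subset n)) → List (Subset n) → Subset (length bs)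
mergedGaps acc []       zs       = []
mergedGaps acc (B ∷ bs) []       = true ∷ mergedGaps (acc ∪ B) bs []
mergedGaps acc (B ∷ bs) (Z ∷ zs) with Z ≟ₛ acc
... | yes _ = false ∷ mergedGaps B bs zs
... | no  _ = true  ∷ mergedGaps (acc ∪ B) bs (Z ∷ zs)

coarsen-⊥ : ∀ (acc : Subset n) bs → coarsen acc bs ⊥ ≡ acc ∷ bs
coarsen-⊥ acc []       = refl
coarsen-⊥ acc (B ∷ bs) = cong (acc ∷_) (coarsen-⊥ B bs)

coarsen-head : ∀ (acc : Subset n) bs c → ∃[ Z ] ∃[ Zs ] coarsen acc bs c ≡ Z ∷ Zs × acc ⊆ Z
coarsen-head acc []       []          = acc , [] , refl , λ x∈ → x∈
coarsen-head acc (B ∷ bs) (true  ∷ c) =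
  let (Z , Zs , eq , acc∪B⊆Z) = coarsen-head (acc ∪ B) bs c in Z , Zs , eq , λ x∈ → acc∪B⊆Z (x∈p∪q⁺ (inj₁ x∈))
coarsen-head acc (B ∷ bs) (false ∷ c) = acc , coarsen B bs c , refl , λ x∈ → x∈

coarsen-∪-head : ∀ acc (B : Subset n) bs c {Z Zs} → coarsen B bs c ≡ Z ∷ Zs →
                 coarsen (acc ∪ B) bs c ≡ (acc ∪ Z) ∷ Zs
coarsen-∪-head acc B []        []          refl = refl
coarsen-∪-head acc B (B′ ∷ bs) (true  ∷ c) eq   =
  trans (cong (λ S → coarsen S bs c) (∪-assoc acc B B′)) (coarsen-∪-head acc (B ∪ B′) bs c eq)
coarsen-∪-head acc B (B′ ∷ bs) (false ∷ c) refl = refl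

merge-coarsen : ∀ (acc B : Subset n) bs c → Merge (acc ∷ coarsen B bs c) (coarsen (acc ∪ B) bs c)
merge-coarsen acc B bs c with coarsen-head B bs c
... | Z , Zs , eq , _ rewrite eq | coarsen-∪-head acc B bs c eq = here

mergedGaps-coarsen : ∀ (acc : Subset n) bs c → FreshBlocks acc bs → mergedGaps acc bs (coarsen acc bs c) ≡ c
mergedGaps-coarsen acc []       []          _ = refl
mergedGaps-coarsen acc (B ∷ bs) (false ∷ c) (_ ∷ disjoint , _ ∷ nonempty) with acc ≟ₛ acc
... | yes _     = cong (false ∷_) (mergedGaps-coarsen B bs c (disjoint , nonempty))
... | no  acc≢acc = contradiction refl acc≢acc
mergedGaps-coarsen acc (B ∷ bs) (true  ∷ c) fresh@((acc#B ∷ _) ∷ _ , (i , i∈B) ∷ _)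
  with coarsen (acc ∪ B) bs c | coarsen-head (acc ∪ B) bs c | mergedGaps-coarsen (acc ∪ B) bs c (freshBlocks-∷⁻ fresh)
... | .(Z ∷ Zs) | Z , Zs , refl , acc∪B⊆Z | ih with Z ≟ₛ acc
...   | yes refl = contradiction i∈B (disjoint⇒∉ acc#B (acc∪B⊆Z (x∈p∪q⁺ (inj₂ i∈B))))
...   | no  _    = cong (true ∷_) ih

coarsen-mono : ∀ (acc : Subset n) bs {c c′} → c ⊆ c′ → coarsen acc bs c ⊑ coarsen acc bs c′
coarsen-mono acc []       {[]}        {[]}         _    = ε
coarsen-mono acc (B ∷ bs) {true  ∷ c} {true  ∷ c′} c⊆c′ = coarsen-mono (acc ∪ B) bs (drop-∷-⊆ c⊆c′)
coarsen-mono acc (B ∷ bs) {false ∷ c} {false ∷ c′} c⊆c′ = ⊑-∷ (coarsen-mono B bs (drop-∷-⊆ c⊆c′))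
coarsen-mono acc (B ∷ bs) {false ∷ c} {true  ∷ c′} c⊆c′ =
  ⊑-∷ (coarsen-mono B bs (drop-∷-⊆ c⊆c′)) ◅◅ merge-coarsen acc B bs c′ ◅ ε
coarsen-mono acc (B ∷ bs) {true  ∷ c} {false ∷ c′} c⊆c′ with c⊆c′ here
... | ()

merge-coarsen⁻ : ∀ (acc : Subset n) bs c {ys} → Merge (coarsen acc bs c) ys →
                 ∃[ c′ ] c ⊆ c′ × ys ≡ coarsen acc bs c′
merge-coarsen⁻ acc []       []         (there ())
merge-coarsen⁻ acc (B ∷ bs) (true ∷ c) m =
  let (c′ , c⊆c′ , eq) = merge-coarsen⁻ (acc ∪ B) bs c m in true ∷ c′ , s⊆s c⊆c′ , eq
merge-coarsen⁻ acc (B ∷ bs) (false ∷ c) m with coarsen B bs c in eq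
merge-coarsen⁻ acc (B ∷ bs) (false ∷ c) here       | Z ∷ Zs =
  true ∷ c , out⊆ ⊆-refl , sym (coarsen-∪-head acc B bs c eq)
merge-coarsen⁻ acc (B ∷ bs) (false ∷ c) (there m)  | Z ∷ Zs =
  let (c′ , c⊆c′ , eq′) = merge-coarsen⁻ B bs c (subst (λ zs → Merge zs _) (sym eq) m)
  in false ∷ c′ , s⊆s c⊆c′ , cong (acc ∷_) eq′

⊑-coarsen : ∀ (A : Subset n) xs c → A ∷ xs ⊑ coarsen A xs c
⊑-coarsen A xs c = subst (_⊑ coarsen A xs c) (coarsen-⊥ A xs) (coarsen-mono A xs ⊥⊆)

coarsen-⊑⁻ : ∀ (acc : Subset n) bs c {ys} → coarsen acc bs c ⊑ ys → ∃[ c′ ] c ⊆ c′ × ys ≡ coarsen acc bs c′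
coarsen-⊑⁻ acc bs c ε = c , ⊆-refl , refl
coarsen-⊑⁻ acc bs c (m ◅ ms) with merge-coarsen⁻ acc bs c m
... | c₁ , c⊆c₁ , refl with coarsen-⊑⁻ acc bs c₁ ms
...   | c₂ , c₁⊆c₂ , eq = c₂ , ⊆-trans c⊆c₁ c₁⊆c₂ , eq

⊑⇒≡coarsen : FreshBlocks A xs → A ∷ xs ⊑ ys → ys ≡ coarsen A xs (mergedGaps A xs ys)
⊑⇒≡coarsen {A = A} {xs = xs} {ys = ys} fresh xs⊑ys
  with coarsen-⊑⁻ A xs ⊥ (subst (_⊑ ys) (sym (coarsen-⊥ A xs)) xs⊑ys)
... | c , _ , refl = cong (coarsen A xs) (sym (mergedGaps-coarsen A xs c fresh))

coarsen-⊑⇔ : FreshBlocks A xs → ∀ c c′ → coarsen A xs c ⊑ coarsen A xs c′ ⇔ c ⊆ c′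
coarsen-⊑⇔ {A = A} {xs = xs} fresh c c′ = mk⇔ ⊑⇒⊆ (coarsen-mono A xs)
  where
  ⊑⇒⊆ : coarsen A xs c ⊑ coarsen A xs c′ → c ⊆ c′
  ⊑⇒⊆ c⊑c′ with coarsen-⊑⁻ A xs c c⊑c′
  ... | c″ , c⊆c″ , eq = subst (c ⊆_) c″≡c′ c⊆c″
    where
    c″≡c′ : c″ ≡ c′
    c″≡c′ = trans (sym (mergedGaps-coarsen A xs c″ fresh))
                  (trans (cong (mergedGaps A xs) (sym eq)) (mergedGaps-coarsen A xs c′ fresh))

length-coarsen : ∀ (acc : Subset n) bs c → length (coarsen acc bs c) + ∣ c ∣ ≡ suc (length bs)
length-coarsen acc []       []          = refl
length-coarsen acc (B ∷ bs) (true  ∷ c) = trans (+-suc _ _) (cong suc (length-coarsen (acc ∪ B) bs c))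
length-coarsen acc (B ∷ bs) (false ∷ c) = cong suc (length-coarsen B bs c)

restrict : ∀ {k} (c₀ : Subset k) → Subset k → Subset ∣ c₀ ∣
restrict []           []      = []
restrict (true  ∷ c₀) (b ∷ c) = b ∷ restrict c₀ c
restrict (false ∷ c₀) (_ ∷ c) = restrict c₀ c

expand : ∀ {k} (c₀ : Subset k) → Subset ∣ c₀ ∣ → Subset k
expand []           []      = []
expand (true  ∷ c₀) (b ∷ s) = b ∷ expand c₀ s
expand (false ∷ c₀) s       = false ∷ expand c₀ s

restrict-expand : ∀ {k} (c₀ : Subset k) s → restrict c₀ (expand c₀ s) ≡ s
restrict-expand []           []      = refl
restrict-expand (true  ∷ c₀) (b ∷ s) = cong (b ∷_) (restrict-expand c₀ s)
restrict-expand (false ∷ c₀) s       = restrict-expand c₀ s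

expand-restrict : ∀ {k} (c₀ c : Subset k) → c ⊆ c₀ → expand c₀ (restrict c₀ c) ≡ c
expand-restrict []           []          _    = refl
expand-restrict (true  ∷ c₀) (b ∷ c)     c⊆c₀ = cong (b ∷_) (expand-restrict c₀ c (drop-∷-⊆ c⊆c₀))
expand-restrict (false ∷ c₀) (false ∷ c) c⊆c₀ = cong (false ∷_) (expand-restrict c₀ c (drop-∷-⊆ c⊆c₀))
expand-restrict (false ∷ c₀) (true  ∷ c) c⊆c₀ with c⊆c₀ here
... | ()

expand-⊆ : ∀ {k} (c₀ : Subset k) s → expand c₀ s ⊆ c₀
expand-⊆ (true  ∷ c₀) (b ∷ s) here      = here
expand-⊆ (true  ∷ c₀) (b ∷ s) (there x∈) = there (expand-⊆ c₀ s x∈)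
expand-⊆ (false ∷ c₀) s       (there x∈) = there (expand-⊆ c₀ s x∈)

restrict-mono : ∀ {k} (c₀ : Subset k) {c c′} → c ⊆ c′ → restrict c₀ c ⊆ restrict c₀ c′
restrict-mono (true  ∷ c₀) {true ∷ c} {b ∷ c′} c⊆c′ here with c⊆c′ here
... | here = here
restrict-mono (true  ∷ c₀) {_ ∷ c} {_ ∷ c′} c⊆c′ (there x∈) = there (restrict-mono c₀ (drop-∷-⊆ c⊆c′) x∈)
restrict-mono (false ∷ c₀) {_ ∷ c} {_ ∷ c′} c⊆c′ x∈         = restrict-mono c₀ (drop-∷-⊆ c⊆c′) x∈

expand-mono : ∀ {k} (c₀ : Subset k) {s s′} → s ⊆ s′ → expand c₀ s ⊆ expand c₀ s′
expand-mono (true  ∷ c₀) {true ∷ s} {b ∷ s′} s⊆s′ here with s⊆s′ here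
... | here = here
expand-mono (true  ∷ c₀) {_ ∷ s} {_ ∷ s′} s⊆s′ (there x∈) = there (expand-mono c₀ (drop-∷-⊆ s⊆s′) x∈)
expand-mono (false ∷ c₀) s⊆s′ (there x∈) = there (expand-mono c₀ s⊆s′ x∈)



-- Joins and meets of chains

-- The join of two partitions keeps exactly the gaps whose prefix union lies on both chains.
module _ (Y : List (Subset n)) where

  gapsOffChain : Subset n → Subset n → (bs : List (Subset n)) → Subset (length bs)
  gapsOffChain base A []       = []
  gapsOffChain base A (B ∷ bs) with Any.any? ((base ∪ A) ≟ₛ_) Y
  ... | yes _ = false ∷ gapsOffChain (base ∪ A) B bs
  ... | no  _ = true  ∷ gapsOffChain base (A ∪ B) bs

  prefixUnions-gapsOffChain⁻ : ∀ base A bs {P} → P ∈ₗ prefixUnions base (coarsen A bs (gapsOffChain base A bs)) →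
                               P ∈ₗ Y ⊎ P ≡ foldl _∪_ (base ∪ A) bs
  prefixUnions-gapsOffChain⁻ base A []       (here P≡) = inj₂ P≡
  prefixUnions-gapsOffChain⁻ base A (B ∷ bs) P∈ with Any.any? ((base ∪ A) ≟ₛ_) Y
  prefixUnions-gapsOffChain⁻ base A (B ∷ bs) (here refl) | yes base∪A∈Y = inj₁ base∪A∈Y
  prefixUnions-gapsOffChain⁻ base A (B ∷ bs) (there P∈)  | yes _ = prefixUnions-gapsOffChain⁻ (base ∪ A) B bs P∈
  prefixUnions-gapsOffChain⁻ base A (B ∷ bs) P∈          | no  _ with prefixUnions-gapsOffChain⁻ base (A ∪ B) bs P∈
  ... | inj₁ P∈Y = inj₁ P∈Y
  ... | inj₂ P≡  = inj₂ (trans P≡ (cong (λ S → foldl _∪_ S bs) (sym (∪-assoc base A B))))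

  prefixUnions-gapsOffChain⁺ : ∀ base A bs {P} → P ∈ₗ prefixUnions base (A ∷ bs) → P ∈ₗ Y →
                               P ∈ₗ prefixUnions base (coarsen A bs (gapsOffChain base A bs))
  prefixUnions-gapsOffChain⁺ base A []       P∈ _ = P∈
  prefixUnions-gapsOffChain⁺ base A (B ∷ bs) P∈ P∈Y with Any.any? ((base ∪ A) ≟ₛ_) Y
  prefixUnions-gapsOffChain⁺ base A (B ∷ bs) (here P≡)  P∈Y | yes _ = here P≡
  prefixUnions-gapsOffChain⁺ base A (B ∷ bs) (there P∈) P∈Y | yes _ =
    there (prefixUnions-gapsOffChain⁺ (base ∪ A) B bs P∈ P∈Y)
  prefixUnions-gapsOffChain⁺ base A (B ∷ bs) (here refl) P∈Y | no base∪A∉Y = contradiction P∈Y base∪A∉Y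
  prefixUnions-gapsOffChain⁺ base A (B ∷ bs) {P} (there P∈) P∈Y | no _ =
    prefixUnions-gapsOffChain⁺ base (A ∪ B) bs
      (subst (P ∈ₗ_) (cong (λ S → S ∷ prefixUnions S bs) (∪-assoc base A B)) P∈) P∈Y

foldl-∪∈prefixUnions : ∀ (acc : Subset n) ys → ys ≢ [] → foldl _∪_ acc ys ∈ₗ prefixUnions acc ys
foldl-∪∈prefixUnions acc []            ys≢[] = contradiction refl ys≢[]
foldl-∪∈prefixUnions acc (Y ∷ [])      _     = here refl
foldl-∪∈prefixUnions acc (Y ∷ Y′ ∷ ys) _     = there (foldl-∪∈prefixUnions (acc ∪ Y) (Y′ ∷ ys) (λ ()))

⊤∈chain : ∀ {d} → IsDOSP d ys → ⊤ ∈ₗ chain ys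
⊤∈chain {ys = ys} (ys≢[] , _ , _ , covers , _) =
  subst (_∈ₗ chain ys) (foldl-∪-⊤ ⊥ ys covers) (foldl-∪∈prefixUnions ⊥ ys ys≢[])


module Meets (d : ℕ) where

  IsDOSPOutside : Subset n → List (Subset n) → Set
  IsDOSPOutside acc bs = FreshBlocks acc bs × Covers acc bs × All (λ B → d ∣ ∣ B ∣) bs

  IsDOSPOutside-∷⁻ : IsDOSPOutside acc (A ∷ xs) → IsDOSPOutside (acc ∪ A) xs
  IsDOSPOutside-∷⁻ (fresh , covers , _ ∷ divisible) = freshBlocks-∷⁻ fresh , covers-∷⁻ covers , divisible

  IsDOSPOutside-∷⁺ : IsDOSPOutside acc (A ∷ xs) → IsDOSPOutside (acc ∪ A) ys → IsDOSPOutside acc (A ∷ ys)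
  IsDOSPOutside-∷⁺ {acc = acc} {A = A} (((acc#A ∷ _) ∷ _ , nonemptyA ∷ _) , _ , d∣A ∷ _)
                   ((acc∪A#ys ∷ #ys , nonempty) , covers , divisible) =
    ((acc#A ∷ All.map (disjoint-⊆ˡ (p⊆p∪q A)) acc∪A#ys) ∷ All.map (disjoint-⊆ˡ (q⊆p∪q acc A)) acc∪A#ys ∷ #ys ,
     nonemptyA ∷ nonempty) ,
    covers′ , d∣A ∷ divisible
    where
    covers′ : Covers acc (A ∷ _)
    covers′ i with covers i
    ... | inj₂ i∈ys  = inj₂ (there i∈ys)
    ... | inj₁ i∈acc∪A with x∈p∪q⁻ acc A i∈acc∪A
    ...   | inj₁ i∈acc = inj₁ i∈acc
    ...   | inj₂ i∈A   = inj₂ (here i∈A)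

  IsDOSPOutside-─ : IsDOSPOutside acc (B ∷ ys) → A ⊆ B → A ≢ B → Disjoint acc A → d ∣ ∣ A ∣ →
                    IsDOSPOutside (acc ∪ A) ((B ─ A) ∷ ys)
  IsDOSPOutside-─ {acc = acc} {B = B} {ys = ys} {A = A}
                  (((acc#B ∷ acc#ys) ∷ B#ys ∷ #ys , _ ∷ nonempty) , covers , d∣B ∷ divisible) A⊆B A≢B acc#A d∣A =
    ((disjoint-∪ˡ (disjoint-⊆ʳ (p─q⊆p B A) acc#B) (disjoint-sym (p─q-disjoint B A))
       ∷ All.zipWith (λ (acc#Y , B#Y) → disjoint-∪ˡ acc#Y (disjoint-⊆ˡ A⊆B B#Y)) (acc#ys , B#ys))
     ∷ All.map (disjoint-⊆ˡ (p─q⊆p B A)) B#ys ∷ #ys ,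
     ⊂⇒nonempty-─ A⊆B A≢B ∷ nonempty) ,
    covers′ ,
    ∣m+n∣m⇒∣n (subst (d ∣_) (trans (sym (∣p─q∣+∣q∣≡∣p∣ A⊆B)) (+-comm _ ∣ A ∣)) d∣B) d∣A ∷ divisible
    where
    covers′ : Covers (acc ∪ A) ((B ─ A) ∷ ys)
    covers′ i with covers i
    ... | inj₁ i∈acc         = inj₁ (x∈p∪q⁺ (inj₁ i∈acc))
    ... | inj₂ (there i∈ys)  = inj₂ (there i∈ys)
    ... | inj₂ (here i∈B) with i ∈? A
    ...   | yes i∈A = inj₁ (x∈p∪q⁺ (inj₂ i∈A))
    ...   | no  i∉A = inj₂ (here (x∈p∧x∉q⇒x∈p─q i∈B i∉A))

  IsDOSP⇒IsDOSPOutside-⊥ : IsDOSP d (A ∷ xs) → IsDOSPOutside ⊥ (A ∷ xs)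
  IsDOSP⇒IsDOSPOutside-⊥ (_ , nonempty , disjoint , covers , divisible) =
    (All.tabulate (λ {B} _ → ⊥-disjoint B) ∷ disjoint , nonempty) , inj₂ ∘ covers , divisible

  IsDOSPOutside-⊥⇒IsDOSP : xs ≢ [] → IsDOSPOutside ⊥ xs → IsDOSP d xs
  IsDOSPOutside-⊥⇒IsDOSP xs≢[] ((_ ∷ disjoint , nonempty) , covers , divisible) =
    xs≢[] , nonempty , disjoint , Sum.[ (λ i∈⊥ → contradiction i∈⊥ ∉⊥) , (λ i∈xs → i∈xs) ] ∘ covers , divisible

  no-room : IsDOSPOutside acc (A ∷ []) → Disjoint acc C → Disjoint A C → ¬ Nonempty C
  no-room (_ , covers , _) acc#C A#C (i , i∈C) with covers i
  ... | inj₁ i∈acc       = disjoint⇒∉ acc#C i∈acc i∈C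
  ... | inj₂ (here i∈A)  = disjoint⇒∉ A#C i∈A i∈C

  IsChain : List (Subset n) → Set
  IsChain C = ∀ {P Q} → P ∈ₗ C → Q ∈ₗ C → P ⊆ Q ⊎ Q ⊆ P

  -- The meet of two partitions has as its chain the union of their chains, if that is a chain.
  record CommonRefinement (acc : Subset n) (xs ys : List (Subset n)) : Set where
    field
      blocks   : List (Subset n)
      nonNil   : blocks ≢ []
      valid    : IsDOSPOutside acc blocks
      sound    : ∀ {P} → P ∈ₗ prefixUnions acc blocks → P ∈ₗ prefixUnions acc xs ⊎ P ∈ₗ prefixUnions acc ys
      complete : ∀ {P} → P ∈ₗ prefixUnions acc xs ⊎ P ∈ₗ prefixUnions acc ys → P ∈ₗ prefixUnions acc blocks

  open CommonRefinement

  NoCommonRefinement : Subset n → List (Subset n) → List (Subset n) → Set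
  NoCommonRefinement acc xs ys = ∀ C → IsChain C → prefixUnions acc xs ⊆ₗ C → ¬ (prefixUnions acc ys ⊆ₗ C)

  CommonRefinement-swap : CommonRefinement acc xs ys → CommonRefinement acc ys xs
  CommonRefinement-swap r = record
    { blocks = blocks r ; nonNil = nonNil r ; valid = valid r
    ; sound = Sum.swap ∘ sound r ; complete = complete r ∘ Sum.swap }

  NoCommonRefinement-swap : NoCommonRefinement acc xs ys → NoCommonRefinement acc ys xs
  NoCommonRefinement-swap none C isChain ys⊆C xs⊆C = none C isChain xs⊆C ys⊆C

  module _ (ys⊆ : prefixUnions acc ys ⊆ₗ (acc ∪ A) ∷ prefixUnions (acc ∪ A) zs)
           (⊆ys : prefixUnions (acc ∪ A) zs ⊆ₗ prefixUnions acc ys) where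

    CommonRefinement-∷ : IsDOSPOutside acc (A ∷ xs) → CommonRefinement (acc ∪ A) xs zs → CommonRefinement acc (A ∷ xs) ys
    CommonRefinement-∷ v r = record
      { blocks = A ∷ blocks r ; nonNil = λ () ; valid = IsDOSPOutside-∷⁺ v (valid r)
      ; sound = sound′ ; complete = complete′ }
      where
      sound′ : ∀ {P} → P ∈ₗ (acc ∪ A) ∷ prefixUnions (acc ∪ A) (blocks r) →
               P ∈ₗ prefixUnions acc (A ∷ _) ⊎ P ∈ₗ prefixUnions acc ys
      sound′ (here P≡)  = inj₁ (here P≡)
      sound′ (there P∈) = Sum.map there ⊆ys (sound r P∈)
      complete′ : ∀ {P} → P ∈ₗ prefixUnions acc (A ∷ _) ⊎ P ∈ₗ prefixUnions acc ys →
                  P ∈ₗ (acc ∪ A) ∷ prefixUnions (acc ∪ A) (blocks r)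
      complete′ (inj₁ (here P≡))  = here P≡
      complete′ (inj₁ (there P∈)) = there (complete r (inj₁ P∈))
      complete′ (inj₂ P∈) with ys⊆ P∈
      ... | here P≡  = here P≡
      ... | there P∈zs = there (complete r (inj₂ P∈zs))

    NoCommonRefinement-∷ : NoCommonRefinement (acc ∪ A) xs zs → NoCommonRefinement acc (A ∷ xs) ys
    NoCommonRefinement-∷ none C isChain xs⊆C ys⊆C = none C isChain (xs⊆C ∘ there) (ys⊆C ∘ ⊆ys)

  meet? : ∀ acc A xs B ys → IsDOSPOutside {n} acc (A ∷ xs) → IsDOSPOutside acc (B ∷ ys) →
          CommonRefinement acc (A ∷ xs) (B ∷ ys) ⊎ NoCommonRefinement acc (A ∷ xs) (B ∷ ys)
  meet? acc A xs B ys vx vy with A ≟ₛ B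
  meet? acc A []        _ []        vx vy | yes refl = inj₁ (record
    { blocks = A ∷ [] ; nonNil = λ () ; valid = vx ; sound = inj₁ ; complete = Sum.[ (λ P∈ → P∈) , (λ P∈ → P∈) ] })
  meet? acc A (A′ ∷ xs) _ (B′ ∷ ys) vx vy | yes refl =
    Sum.map (CommonRefinement-∷ (λ P∈ → P∈) there vx) (NoCommonRefinement-∷ (λ P∈ → P∈) there)
            (meet? (acc ∪ A) A′ xs B′ ys (IsDOSPOutside-∷⁻ vx) (IsDOSPOutside-∷⁻ vy))
  meet? acc A []        _ (B′ ∷ ys) vx (((_ ∷ acc#B′ ∷ _) ∷ (A#B′ ∷ _) ∷ _ , _ ∷ nonemptyB′ ∷ _) , _) | yes refl =
    ⊥-elim (no-room vx acc#B′ A#B′ nonemptyB′)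
  meet? acc A (A′ ∷ xs) _ []        (((_ ∷ acc#A′ ∷ _) ∷ (A#A′ ∷ _) ∷ _ , _ ∷ nonemptyA′ ∷ _) , _) vy | yes refl =
    ⊥-elim (no-room vy acc#A′ A#A′ nonemptyA′)
  meet? acc A xs B ys vx vy | no A≢B with A ⊆? B
  meet? acc A []        B ys vx vy@(((acc#B ∷ _) ∷ _ , _) , _) | no A≢B | yes A⊆B =
    ⊥-elim (no-room vx (disjoint-⊆ʳ (p─q⊆p B A) acc#B) (disjoint-sym (p─q-disjoint B A)) (⊂⇒nonempty-─ A⊆B A≢B))
  meet? acc A (A′ ∷ xs) B ys vx@(((acc#A ∷ _) ∷ _ , _) , _ , d∣A ∷ _) vy | no A≢B | yes A⊆B =
    Sum.map (CommonRefinement-∷ ys⊆ ⊆ys vx) (NoCommonRefinement-∷ ys⊆ ⊆ys)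
            (meet? (acc ∪ A) A′ xs (B ─ A) ys (IsDOSPOutside-∷⁻ vx) (IsDOSPOutside-─ vy A⊆B A≢B acc#A d∣A))
    where
    ⊆ys : prefixUnions (acc ∪ A) ((B ─ A) ∷ ys) ⊆ₗ prefixUnions acc (B ∷ ys)
    ⊆ys {P} P∈ = subst (P ∈ₗ_) (prefixUnions-─ acc ys A⊆B) P∈
    ys⊆ : prefixUnions acc (B ∷ ys) ⊆ₗ (acc ∪ A) ∷ prefixUnions (acc ∪ A) ((B ─ A) ∷ ys)
    ys⊆ {P} P∈ = there (subst (P ∈ₗ_) (sym (prefixUnions-─ acc ys A⊆B)) P∈)
  meet? acc A xs B ys vx vy | no A≢B | no A⊈B with B ⊆? A
  meet? acc A xs B []        vx@(((acc#A ∷ _) ∷ _ , _) , _) vy | no A≢B | no _ | yes B⊆A =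
    ⊥-elim (no-room vy (disjoint-⊆ʳ (p─q⊆p A B) acc#A) (disjoint-sym (p─q-disjoint A B))
                    (⊂⇒nonempty-─ B⊆A (A≢B ∘ sym)))
  meet? acc A xs B (B′ ∷ ys) vx vy@(((acc#B ∷ _) ∷ _ , _) , _ , d∣B ∷ _) | no A≢B | no _ | yes B⊆A =
    Sum.map (CommonRefinement-swap ∘ CommonRefinement-∷ xs⊆ ⊆xs vy ∘ CommonRefinement-swap)
            (NoCommonRefinement-swap ∘ NoCommonRefinement-∷ xs⊆ ⊆xs ∘ NoCommonRefinement-swap)
            (meet? (acc ∪ B) (A ─ B) xs B′ ys (IsDOSPOutside-─ vx B⊆A (A≢B ∘ sym) acc#B d∣B) (IsDOSPOutside-∷⁻ vy))
    where
    ⊆xs : prefixUnions (acc ∪ B) ((A ─ B) ∷ xs) ⊆ₗ prefixUnions acc (A ∷ xs)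
    ⊆xs {P} P∈ = subst (P ∈ₗ_) (prefixUnions-─ acc xs B⊆A) P∈
    xs⊆ : prefixUnions acc (A ∷ xs) ⊆ₗ (acc ∪ B) ∷ prefixUnions (acc ∪ B) ((A ─ B) ∷ xs)
    xs⊆ {P} P∈ = there (subst (P ∈ₗ_) (sym (prefixUnions-─ acc xs B⊆A)) P∈)
  meet? acc A xs B ys vx vy | no _ | no A⊈B | no B⊈A = inj₂ incomparable
    where
    incomparable : NoCommonRefinement acc (A ∷ xs) (B ∷ ys)
    incomparable C isChain xs⊆C ys⊆C with isChain (xs⊆C (here refl)) (ys⊆C (here refl))
    ... | inj₁ ⊆ = A⊈B (∪-⊆-cancelˡ (All.head (AllPairs.head (proj₁ (proj₁ vx)))) ⊆)
    ... | inj₂ ⊇ = B⊈A (∪-⊆-cancelˡ (All.head (AllPairs.head (proj₁ (proj₁ vy)))) ⊇)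


-- Arrangements

LehmerCode : ℕ → Set
LehmerCode zero    = Unit
LehmerCode (suc k) = Fin (suc k) × LehmerCode k

Fin[k!]↔LehmerCode : ∀ k → Fin (k !) ↔ LehmerCode k
Fin[k!]↔LehmerCode zero    = mk↔ₛ′ (λ _ → tt) (λ _ → zero) (λ _ → refl) λ { zero → refl }
Fin[k!]↔LehmerCode (suc k) = (↔-id (Fin (suc k)) ×-↔ Fin[k!]↔LehmerCode k) ↔-∘ Finₚ.*↔×

infix 4 _∈ᵥ_

_∈ᵥ_ : ∀ {X : Set} {k} → X → Vec X k → Set
x ∈ᵥ v = ∃[ i ] Vec.lookup v i ≡ x

InjectiveVec : ∀ {X : Set} {k} → Vec X k → Set
InjectiveVec v = Injective _≡_ _≡_ (Vec.lookup v)

-- A Lehmer code (i₀ , i₁ , …) rearranges a vector by repeatedly taking out the entry at position iⱼ.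
module Arrangements {X : Set} (_≟_ : DecidableEquality X) where

  arrange : ∀ {k} → Vec X k → LehmerCode k → Vec X k
  arrange {zero}  []       _       = []
  arrange {suc k} v        (i , c) = Vec.lookup v i ∷ arrange (Vec.removeAt v i) c

  -- The first index of x in v, and 0 if x does not occur.
  position : ∀ {k} → X → Vec X (suc k) → Fin (suc k)
  position {zero}  x (y ∷ []) = zero
  position {suc k} x (y ∷ v) with x ≟ y
  ... | yes _ = zero
  ... | no  _ = suc (position x v)

  codeOf : ∀ {k} → Vec X k → Vec X k → LehmerCode k
  codeOf {zero}  []       []      = tt
  codeOf {suc k} v        (x ∷ w) = position x v , codeOf (Vec.removeAt v (position x v)) w

  lookup-removeAt : ∀ {k} (v : Vec X (suc k)) i j → Vec.lookup (Vec.removeAt v i) j ≡ Vec.lookup v (punchIn i j)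
  lookup-removeAt (x ∷ v)     zero    j       = refl
  lookup-removeAt (x ∷ y ∷ v) (suc i) zero    = refl
  lookup-removeAt (x ∷ y ∷ v) (suc i) (suc j) = lookup-removeAt (y ∷ v) i j

  removeAt-injective : ∀ {k} (v : Vec X (suc k)) i → InjectiveVec v → InjectiveVec (Vec.removeAt v i)
  removeAt-injective v i inj {a} {b} eq =
    Finₚ.punchIn-injective i a b (inj (trans (sym (lookup-removeAt v i a)) (trans eq (lookup-removeAt v i b))))

  ∷-injectiveVec⁻ : ∀ {k} x (v : Vec X k) → InjectiveVec (x ∷ v) → InjectiveVec v
  ∷-injectiveVec⁻ x v inj eq = Finₚ.suc-injective (inj eq)

  ∈-removeAt : ∀ {k x} (v : Vec X (suc k)) i → x ∈ᵥ v → x ≢ Vec.lookup v i → x ∈ᵥ Vec.removeAt v i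
  ∈-removeAt v i (j , refl) x≢ = punchOut i≢j , Vecₚ.removeAt-punchOut v i≢j
    where
    i≢j : i ≢ j
    i≢j refl = x≢ refl

  lookup-position : ∀ {k} x (v : Vec X (suc k)) → x ∈ᵥ v → Vec.lookup v (position x v) ≡ x
  lookup-position {zero}  x (y ∷ [])  (zero , y≡x) = y≡x
  lookup-position {suc k} x (y ∷ v)   x∈ with x ≟ y
  ... | yes x≡y = sym x≡y
  lookup-position {suc k} x (y ∷ v) (zero  , y≡x) | no x≢y = contradiction (sym y≡x) x≢y
  lookup-position {suc k} x (y ∷ v) (suc j , eq)  | no _   = lookup-position x v (j , eq)

  position-lookup : ∀ {k} (v : Vec X (suc k)) i → InjectiveVec v → position (Vec.lookup v i) v ≡ i
  position-lookup {zero}  (y ∷ []) zero inj = refl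
  position-lookup {suc k} (y ∷ v)  i    inj with Vec.lookup (y ∷ v) i ≟ y
  ... | yes vᵢ≡y = inj {zero} {i} (sym vᵢ≡y)
  position-lookup {suc k} (y ∷ v) zero    inj | no y≢y = contradiction refl y≢y
  position-lookup {suc k} (y ∷ v) (suc j) inj | no _   = cong suc (position-lookup v j (∷-injectiveVec⁻ y v inj))

  ∈-arrange⁻ : ∀ {k x} (v : Vec X k) c → x ∈ᵥ arrange v c → x ∈ᵥ v
  ∈-arrange⁻ {suc k} v (i , c) (zero  , eq) = i , eq
  ∈-arrange⁻ {suc k} v (i , c) (suc j , eq) with ∈-arrange⁻ (Vec.removeAt v i) c (j , eq)
  ... | j′ , eq′ = punchIn i j′ , trans (sym (lookup-removeAt v i j′)) eq′

  ∈-arrange⁺ : ∀ {k x} (v : Vec X k) c → x ∈ᵥ v → x ∈ᵥ arrange v c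
  ∈-arrange⁺ {suc k} {x} v (i , c) x∈ with x ≟ Vec.lookup v i
  ... | yes x≡vᵢ = zero , sym x≡vᵢ
  ... | no  x≢vᵢ with ∈-arrange⁺ (Vec.removeAt v i) c (∈-removeAt v i x∈ x≢vᵢ)
  ...   | j , eq = suc j , eq

  removed∉arrange : ∀ {k} (v : Vec X (suc k)) i c b → InjectiveVec v →
                    Vec.lookup (arrange (Vec.removeAt v i) c) b ≢ Vec.lookup v i
  removed∉arrange v i c b inj eq with ∈-arrange⁻ (Vec.removeAt v i) c (b , refl)
  ... | j , eq′ = Finₚ.punchInᵢ≢i i j (inj (trans (sym (lookup-removeAt v i j)) (trans eq′ eq)))

  arrange-injective : ∀ {k} (v : Vec X k) c → InjectiveVec v → InjectiveVec (arrange v c)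
  arrange-injective {suc k} v (i , c) inj {zero}  {zero}  _  = refl
  arrange-injective {suc k} v (i , c) inj {zero}  {suc b} eq = ⊥-elim (removed∉arrange v i c b inj (sym eq))
  arrange-injective {suc k} v (i , c) inj {suc a} {zero}  eq = ⊥-elim (removed∉arrange v i c a inj eq)
  arrange-injective {suc k} v (i , c) inj {suc a} {suc b} eq =
    cong suc (arrange-injective (Vec.removeAt v i) c (removeAt-injective v i inj) eq)

  codeOf-arrange : ∀ {k} (v : Vec X k) c → InjectiveVec v → codeOf v (arrange v c) ≡ c
  codeOf-arrange {zero}  [] tt      inj = refl
  codeOf-arrange {suc k} v  (i , c) inj rewrite position-lookup v i inj =
    cong (i ,_) (codeOf-arrange (Vec.removeAt v i) c (removeAt-injective v i inj))

  arrange-codeOf : ∀ {k} (v w : Vec X k) → InjectiveVec w → (∀ j → Vec.lookup w j ∈ᵥ v) → arrange v (codeOf v w) ≡ w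
  arrange-codeOf {zero}  [] []      _   _  = refl
  arrange-codeOf {suc k} v  (x ∷ w) inj w⊆v = cong₂ _∷_ (lookup-position x v (w⊆v zero))
    (arrange-codeOf (Vec.removeAt v (position x v)) w (∷-injectiveVec⁻ x w inj)
      λ j → ∈-removeAt v _ (w⊆v (suc j))
              λ wⱼ≡ → Finₚ.0≢1+n (sym (inj (trans wⱼ≡ (lookup-position x v (w⊆v zero))))))

module _ {X : Set} where

  toVec : ∀ {k} (xs : List X) → .(length xs ≡ k) → Vec X k
  toVec xs eq = Vec.cast eq (Vec.fromList xs)

  toList-toVec : ∀ {k} (xs : List X) .(eq : length xs ≡ k) → Vec.toList (toVec xs eq) ≡ xs
  toList-toVec xs eq = trans (Vecₚ.toList-cast eq (Vec.fromList xs)) (Vecₚ.toList∘fromList xs)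

  toVec-toList : ∀ {k} (v : Vec X k) .(eq : length (Vec.toList v) ≡ k) → toVec (Vec.toList v) eq ≡ v
  toVec-toList v eq = Vecₚ.fromList∘toList v

  ∈ᵥ⇒∈toList : ∀ {k x} (v : Vec X k) → x ∈ᵥ v → x ∈ₗ Vec.toList v
  ∈ᵥ⇒∈toList v (i , refl) = VecMembershipₚ.∈-toList⁺ (VecMembershipₚ.∈-lookup i v)

  ∈toList⇒∈ᵥ : ∀ {k x} (v : Vec X k) → x ∈ₗ Vec.toList v → x ∈ᵥ v
  ∈toList⇒∈ᵥ v x∈ = let x∈v = VecMembershipₚ.∈-toList⁻ x∈ in VecAny.index x∈v , sym (VecAnyₚ.lookup-index x∈v)

  unique⇒injectiveVec : ∀ {k} (v : Vec X k) → Unique (Vec.toList v) → InjectiveVec v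
  unique⇒injectiveVec (x ∷ v) u {zero}  {zero}  _  = refl
  unique⇒injectiveVec (x ∷ v) (x∉v ∷ _) {zero}  {suc j} eq = ⊥-elim (All.lookup x∉v (∈ᵥ⇒∈toList v (j , refl)) eq)
  unique⇒injectiveVec (x ∷ v) (x∉v ∷ _) {suc i} {zero}  eq = ⊥-elim (All.lookup x∉v (∈ᵥ⇒∈toList v (i , refl)) (sym eq))
  unique⇒injectiveVec (x ∷ v) (_ ∷ u)   {suc i} {suc j} eq = cong suc (unique⇒injectiveVec v u eq)

  injectiveVec⇒unique : ∀ {k} (v : Vec X k) → InjectiveVec v → Unique (Vec.toList v)
  injectiveVec⇒unique []      _   = []
  injectiveVec⇒unique (x ∷ v) inj =
    All.tabulate (λ y∈ x≡y → let (j , vⱼ≡y) = ∈toList⇒∈ᵥ v y∈ in Finₚ.0≢1+n (inj (trans x≡y (sym vⱼ≡y))))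
    ∷ injectiveVec⇒unique v (Finₚ.suc-injective ∘ inj)

  unique⇒AllPairs : ∀ {R : X → X → Set} {xs} → Unique xs →
                    (∀ {x y} → x ∈ₗ xs → y ∈ₗ xs → x ≢ y → R x y) → AllPairs R xs
  unique⇒AllPairs []          _ = []
  unique⇒AllPairs (x∉xs ∷ u) R-≢ =
    All.tabulate (λ y∈ → R-≢ (here refl) (there y∈) (All.lookup x∉xs y∈))
    ∷ unique⇒AllPairs u (λ x∈ y∈ → R-≢ (there x∈) (there y∈))

  AllPairs-lookup : ∀ {R : X → X → Set} {xs x y} → AllPairs R xs → x ∈ₗ xs → y ∈ₗ xs → x ≢ y → R x y ⊎ R y x
  AllPairs-lookup (_ ∷ _)       (here refl) (here refl) x≢y = contradiction refl x≢y
  AllPairs-lookup (Rx ∷ _)      (here refl) (there y∈)  _   = inj₁ (All.lookup Rx y∈)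
  AllPairs-lookup (Ry ∷ _)      (there x∈)  (here refl) _   = inj₂ (All.lookup Ry x∈)
  AllPairs-lookup (_ ∷ Rs)      (there x∈)  (there y∈)  x≢y = AllPairs-lookup Rs x∈ y∈ x≢y

  unique⇒Fin↔ : DecidableEquality X → ∀ {P : X → Set} xs → Unique xs →
                (∀ {x} → x ∈ₗ xs → P x) → (∀ {x} → P x → x ∈ₗ xs) → Fin (length xs) ↔ Sub X P
  unique⇒Fin↔ _≟_ {P} xs u xs⊆P P⊆xs = mk↔ₛ′ to from to-from from-to
    where
    to : Fin (length xs) → Sub X P
    to i = Data.List.lookup xs i ,ₛ xs⊆P (Membershipₚ.∈-lookup i)
    from : Sub X P → Fin (length xs)
    from (x ,ₛ px) = Any.index (recompute (Any.any? (x ≟_) xs) (P⊆xs px))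
    to-from : ∀ s → to (from s) ≡ s
    to-from (x ,ₛ px) = Sub-≡ (sym (Anyₚ.lookup-index (recompute (Any.any? (x ≟_) xs) (P⊆xs px))))
    index-unique : ∀ {x} {ys} → Unique ys → (p q : x ∈ₗ ys) → Any.index p ≡ Any.index q
    index-unique _            (here refl) (here refl) = refl
    index-unique (x∉ys ∷ _)   (here refl) (there q)   = contradiction refl (All.lookup x∉ys q)
    index-unique (x∉ys ∷ _)   (there p)   (here refl) = contradiction refl (All.lookup x∉ys p)
    index-unique (_ ∷ u)      (there p)   (there q)   = cong suc (index-unique u p q)
    from-to : ∀ i → from (to i) ≡ i
    from-to i = trans (index-unique u _ (Membershipₚ.∈-lookup i)) (index-∈-lookup xs i)
      where
      index-∈-lookup : ∀ ys i → Any.index (Membershipₚ.∈-lookup {xs = ys} i) ≡ i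
      index-∈-lookup (y ∷ ys) zero    = refl
      index-∈-lookup (y ∷ ys) (suc i) = cong suc (index-∈-lookup ys i)


emptyFamily : Family n
emptyFamily {zero}  = false
emptyFamily {suc n} = emptyFamily , emptyFamily

insertFamily : Subset n → Family n → Family n
insertFamily {zero}  []          _       = true
insertFamily {suc n} (false ∷ B) (f , t) = insertFamily B f , t
insertFamily {suc n} (true  ∷ B) (f , t) = f , insertFamily B t

familyOf : List (Subset n) → Family n
familyOf = Data.List.foldr insertFamily emptyFamily

members : Family n → List (Subset n)
members {zero}  true    = [] ∷ []
members {zero}  false   = []
members {suc n} (f , t) = map (false ∷_) (members f) ++ map (true ∷_) (members t)

∉emptyFamily : ∀ (B : Subset n) → ¬ (B ∈F emptyFamily)
∉emptyFamily {zero}  [] ()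
∉emptyFamily {suc n} (false ∷ B) B∈ = ∉emptyFamily B B∈
∉emptyFamily {suc n} (true  ∷ B) B∈ = ∉emptyFamily B B∈

∈insertFamily⁻ : ∀ (B C : Subset n) F → B ∈F insertFamily C F → B ≡ C ⊎ B ∈F F
∈insertFamily⁻ {zero}  []          []          _       _  = inj₁ refl
∈insertFamily⁻ {suc n} (false ∷ B) (false ∷ C) (f , t) B∈ = Sum.map₁ (cong (false ∷_)) (∈insertFamily⁻ B C f B∈)
∈insertFamily⁻ {suc n} (true  ∷ B) (true  ∷ C) (f , t) B∈ = Sum.map₁ (cong (true ∷_)) (∈insertFamily⁻ B C t B∈)
∈insertFamily⁻ {suc n} (true  ∷ B) (false ∷ C) (f , t) B∈ = inj₂ B∈
∈insertFamily⁻ {suc n} (false ∷ B) (true  ∷ C) (f , t) B∈ = inj₂ B∈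

∈insertFamily⁺ : ∀ (B C : Subset n) F → B ≡ C ⊎ B ∈F F → B ∈F insertFamily C F
∈insertFamily⁺ {zero}  []          []          _       _           = refl
∈insertFamily⁺ {suc n} (false ∷ B) (false ∷ C) (f , t) (inj₁ refl) = ∈insertFamily⁺ B C f (inj₁ refl)
∈insertFamily⁺ {suc n} (true  ∷ B) (true  ∷ C) (f , t) (inj₁ refl) = ∈insertFamily⁺ B C t (inj₁ refl)
∈insertFamily⁺ {suc n} (false ∷ B) (false ∷ C) (f , t) (inj₂ B∈)   = ∈insertFamily⁺ B C f (inj₂ B∈)
∈insertFamily⁺ {suc n} (true  ∷ B) (true  ∷ C) (f , t) (inj₂ B∈)   = ∈insertFamily⁺ B C t (inj₂ B∈)
∈insertFamily⁺ {suc n} (true  ∷ B) (false ∷ C) (f , t) (inj₂ B∈)   = B∈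
∈insertFamily⁺ {suc n} (false ∷ B) (true  ∷ C) (f , t) (inj₂ B∈)   = B∈

∈familyOf⁻ : ∀ (B : Subset n) bs → B ∈F familyOf bs → B ∈ₗ bs
∈familyOf⁻ B []       B∈ = ⊥-elim (∉emptyFamily B B∈)
∈familyOf⁻ B (C ∷ bs) B∈ = Sum.[ here , there ∘ ∈familyOf⁻ B bs ] (∈insertFamily⁻ B C (familyOf bs) B∈)

∈familyOf⁺ : ∀ (B : Subset n) bs → B ∈ₗ bs → B ∈F familyOf bs
∈familyOf⁺ B (C ∷ bs) (here B≡C) = ∈insertFamily⁺ B C (familyOf bs) (inj₁ B≡C)
∈familyOf⁺ B (C ∷ bs) (there B∈) = ∈insertFamily⁺ B C (familyOf bs) (inj₂ (∈familyOf⁺ B bs B∈))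

∈members⁻ : ∀ (B : Subset n) F → B ∈ₗ members F → B ∈F F
∈members⁻ {zero}  [] true  _ = refl
∈members⁻ {suc n} (b ∷ B) (f , t) B∈ with Membershipₚ.∈-++⁻ (map (false ∷_) (members f)) B∈
... | inj₁ B∈f with Membershipₚ.∈-map⁻ (false ∷_) B∈f
...   | B′ , B′∈ , refl = ∈members⁻ B′ f B′∈
∈members⁻ {suc n} (b ∷ B) (f , t) B∈ | inj₂ B∈t with Membershipₚ.∈-map⁻ (true ∷_) B∈t
...   | B′ , B′∈ , refl = ∈members⁻ B′ t B′∈

∈members⁺ : ∀ (B : Subset n) F → B ∈F F → B ∈ₗ members F
∈members⁺ {zero}  []          true    _  = here refl
∈members⁺ {suc n} (false ∷ B) (f , t) B∈ =
  Membershipₚ.∈-++⁺ˡ (Membershipₚ.∈-map⁺ (false ∷_) (∈members⁺ B f B∈))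
∈members⁺ {suc n} (true  ∷ B) (f , t) B∈ =
  Membershipₚ.∈-++⁺ʳ (map (false ∷_) (members f)) (Membershipₚ.∈-map⁺ (true ∷_) (∈members⁺ B t B∈))

members-unique : ∀ (F : Family n) → Unique (members F)
members-unique {zero}  true    = [] ∷ []
members-unique {zero}  false   = []
members-unique {suc n} (f , t) =
  Uniqueₚ.++⁺ (Uniqueₚ.map⁺ Vecₚ.∷-injectiveʳ (members-unique f)) (Uniqueₚ.map⁺ Vecₚ.∷-injectiveʳ (members-unique t))
              λ (B∈f , B∈t) → head-clash (Membershipₚ.∈-map⁻ (false ∷_) B∈f) (Membershipₚ.∈-map⁻ (true ∷_) B∈t)
  where
  head-clash : ∀ {B : Subset (suc n)} →
               ∃[ C ] C ∈ₗ members f × B ≡ false ∷ C → ¬ (∃[ C ] C ∈ₗ members t × B ≡ true ∷ C)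
  head-clash (_ , _ , refl) (_ , _ , ())

family-ext : ∀ (F G : Family n) → (∀ B → B ∈F F → B ∈F G) → (∀ B → B ∈F G → B ∈F F) → F ≡ G
family-ext {zero}  true  true  _ _ = refl
family-ext {zero}  false false _ _ = refl
family-ext {zero}  true  false F⊆G _ with F⊆G [] refl
... | ()
family-ext {zero}  false true  _ G⊆F with G⊆F [] refl
... | ()
family-ext {suc n} (f , t) (f′ , t′) F⊆G G⊆F =
  cong₂ _,_ (family-ext f f′ (F⊆G ∘ (false ∷_)) (G⊆F ∘ (false ∷_)))
            (family-ext t t′ (F⊆G ∘ (true ∷_)) (G⊆F ∘ (true ∷_)))



-- The poset Ω

module Poset (d′ n : ℕ) (d∣n : suc d′ ∣ n) where

  d : ℕ
  d = suc d′

  N : ℕ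
  N = n / d

  open Chunks d′
  open Meets d
  open CommonRefinement
  open Order (_≤Ω_ {n} {d}) using (_⋖_; IsUpperBound; IsLowerBound; IsJoin; IsMeet; Interval; _≤ᴵ_; module WithBottom)
  open WithBottom 0̂ using (IsAtom; IsAtomic; IsRankFunction)

  length≤N : ∀ {xs : List (Subset n)} → IsDOSP d xs → length xs ≤ N
  length≤N {xs = xs} isDOSP@(_ , nonempty , _ , _ , divisible) =
    *-cancelʳ-≤ (length xs) N d (begin
      length xs * d       ≤⟨ length*d≤sum (All.zipWith d≤∣B∣ (divisible , nonempty)) ⟩
      sum (map ∣_∣ xs)    ≡⟨ IsDOSP⇒sum≡n isDOSP ⟩
      n                   ≡⟨ sym (m/n*n≡m d∣n) ⟩
      N * d               ∎)
    where
    open Nₚ.≤-Reasoning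
    d≤∣B∣ : ∀ {B : Subset n} → d ∣ ∣ B ∣ × Nonempty B → d ≤ ∣ B ∣
    d≤∣B∣ {B} (d∣∣B∣ , nonempty) with ∣ B ∣ | nonempty⇒∣p∣>0 nonempty
    ... | suc _ | _ = ∣⇒≤ d∣∣B∣

  length≡N : ∀ {xs : List (Subset n)} → IsDOSP d xs → All (λ B → ∣ B ∣ ≡ d) xs → length xs ≡ N
  length≡N {xs = xs} isDOSP sizes =
    *-cancelʳ-≡ (length xs) N d (trans (length*d≡sum sizes) (trans (IsDOSP⇒sum≡n isDOSP) (sym (m/n*n≡m d∣n))))

  ρ : Ω n d → ℕ
  ρ 0̂          = 0
  ρ (osp xs _) = suc N ∸ length xs

  ρ+length : ∀ xs .(p : IsDOSP d xs) → ρ (osp xs p) + length xs ≡ N + 1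
  ρ+length xs p = trans (m∸n+n≡m (≤-trans (length≤N (recompute-IsDOSP p)) (n≤1+n N))) (+-comm 1 N)

  sizes≡d⇒atom : ∀ xs .(p : IsDOSP d xs) → All (λ B → ∣ B ∣ ≡ d) xs → IsAtom (osp xs p)
  sizes≡d⇒atom xs p sizes = (0̂≤ , λ ()) , between
    where
    between : ∀ z → 0̂ ≤Ω z → z ≤Ω osp xs p → z ≡ 0̂ ⊎ z ≡ osp xs p
    between 0̂ _ _ = inj₁ refl
    between (osp zs q) _ (osp≤ zs⊑xs) with ⊑⇒≡⊎length< zs⊑xs
    ... | inj₁ refl = inj₂ refl
    ... | inj₂ lt   = contradiction (<-≤-trans (subst (_< length zs) (length≡N (recompute-IsDOSP p) sizes) lt)
                                               (length≤N (recompute-IsDOSP q))) (<-irrefl refl)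

  atom⇒sizes≡d : ∀ x → IsAtom x → AllBlocksOfSize d x
  atom⇒sizes≡d 0̂ ((_ , 0̂≢0̂) , _) = contradiction refl 0̂≢0̂
  atom⇒sizes≡d (osp xs p) (_ , between) =
    refinement≡ (between (osp (refine nothing xs) (refine-IsDOSP nothing isDOSP)) 0̂≤ (osp≤ (refine-⊑ nothing chunkable)))
    where
    isDOSP : IsDOSP d xs
    isDOSP = recompute-IsDOSP p
    chunkable : All Chunkable xs
    chunkable = IsDOSP⇒Chunkable isDOSP
    refinement≡ : ∀ .{r} → osp (refine nothing xs) r ≡ 0̂ ⊎ osp (refine nothing xs) r ≡ osp xs p →
                  All (λ B → ∣ B ∣ ≡ d) xs
    refinement≡ (inj₁ ())
    refinement≡ (inj₂ eq) = subst (All (λ B → ∣ B ∣ ≡ d)) (osp-injective eq) (refine-sizes nothing chunkable)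

  atom⇔sizes≡d : ∀ x → IsAtom x ⇔ AllBlocksOfSize d x
  atom⇔sizes≡d x = mk⇔ (atom⇒sizes≡d x) (sizes⇒atom x)
    where
    sizes⇒atom : ∀ x → AllBlocksOfSize d x → IsAtom x
    sizes⇒atom (osp xs p) = sizes≡d⇒atom xs p

  suc[N∸ρ]≡length : ∀ xs .(p : IsDOSP d xs) → suc (N ∸ ρ (osp xs p)) ≡ length xs
  suc[N∸ρ]≡length []       p = contradiction refl (proj₁ (recompute-IsDOSP p))
  suc[N∸ρ]≡length (A ∷ xs) p = cong suc (m∸[m∸n]≡n (≤-trans (n≤1+n _) (length≤N (recompute-IsDOSP p))))

  ρ-⋖ : ∀ x y → x ⋖ y → ρ y ≡ suc (ρ x)
  ρ-⋖ 0̂ 0̂          ((_ , 0̂≢0̂) , _) = contradiction refl 0̂≢0̂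
  ρ-⋖ 0̂ (osp ys q) 0̂⋖y =
    trans (cong (suc N ∸_) (length≡N (recompute-IsDOSP q) (atom⇒sizes≡d _ 0̂⋖y))) (m+n∸n≡m 1 N)
  ρ-⋖ (osp xs p) (osp ys q) ((osp≤ ε , x≢x) , _) = contradiction refl x≢x
  ρ-⋖ (osp xs p) (osp ys q) ((osp≤ (m ◅ ms) , _) , between)
    with between (osp _ (merge-IsDOSP m (recompute-IsDOSP p))) (osp≤ (m ◅ ε)) (osp≤ ms)
  ... | inj₁ eq = contradiction (subst (λ zs → length zs < length xs) (osp-injective eq) (≤-reflexive (sym (merge-length m))))
                                (<-irrefl refl)
  ... | inj₂ eq = begin
    suc N ∸ length ys               ≡⟨ +-∸-assoc 1 (length≤N (recompute-IsDOSP q)) ⟩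
    suc (N ∸ length ys)             ≡⟨ cong (λ k → suc (suc N ∸ k)) (sym length-xs) ⟩
    suc (suc N ∸ length xs)         ∎
    where
    open ≡-Reasoning
    length-xs : length xs ≡ suc (length ys)
    length-xs = trans (merge-length m) (cong (λ zs → suc (length zs)) (osp-injective eq))

  ρ-isRankFunction : IsRankFunction ρ
  ρ-isRankFunction = refl , ρ-⋖

  isAtomic : IsAtomic
  isAtomic x = (λ _ (_ , a≤x) → a≤x) , least x
    where
    least : ∀ x z → IsUpperBound (λ a → IsAtom a × a ≤Ω x) z → x ≤Ω z
    least 0̂         z _  = 0̂≤
    least (osp xs p) z ub =
      ≤z z (λ j → ub (atomAt j) (sizes≡d⇒atom _ _ (refine-sizes j chunkable) , osp≤ (refine-⊑ j chunkable)))
      where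
      isDOSP : IsDOSP d xs
      isDOSP = recompute-IsDOSP p
      chunkable : All Chunkable xs
      chunkable = IsDOSP⇒Chunkable isDOSP
      atomAt : Maybe (Fin n) → Ω n d
      atomAt j = osp (refine j xs) (refine-IsDOSP j isDOSP)
      ≤z : ∀ z → (∀ j → atomAt j ≤Ω z) → osp xs p ≤Ω z
      ≤z 0̂ atoms≤ with atoms≤ nothing
      ... | ()
      ≤z (osp zs q) atoms≤ = osp≤ (chain⊆⇒⊑ isDOSP (recompute-IsDOSP q)
        λ P∈ → prefixUnions-refine⁻ ⊥ xs chunkable (λ j → ⊑⇒prefixUnions⊇ (≤Ω⇒⊑ (atoms≤ j)) P∈))

  -- The coarsenings of A ∷ xs between it and ω = coarsen A xs c₀ are the coarsen A xs c with
  -- c ⊆ c₀, so the interval is the Boolean algebra of subsets of c₀.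
  module _ (A : Subset n) (xs : List (Subset n)) .(p : IsDOSP d (A ∷ xs))
           (ys : List (Subset n)) .(q : IsDOSP d ys) (A∷xs⊑ys : A ∷ xs ⊑ ys) where

    private
      ψ ω : Ω n d
      ψ = osp (A ∷ xs) p
      ω = osp ys q

    fresh : FreshBlocks A xs
    fresh with recompute-IsDOSP p
    ... | _ , _ ∷ nonempty , disjoint , _ = disjoint , nonempty

    c₀ : Subset (length xs)
    c₀ = mergedGaps A xs ys

    gaps : ∀ {zs} → A ∷ xs ⊑ zs → zs ⊑ ys → mergedGaps A xs zs ⊆ c₀
    gaps {zs} ψ⊑zs zs⊑ys with ⊑⇒≡coarsen fresh ψ⊑zs | ⊑⇒≡coarsen fresh (ψ⊑zs ◅◅ zs⊑ys)
    ... | zs≡ | ys≡ = Equivalence.to (coarsen-⊑⇔ fresh _ _) (subst₂ _⊑_ zs≡ ys≡ zs⊑ys)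

    coarsen-∈ : ∀ c → c ⊆ c₀ → Interval ψ ω
    coarsen-∈ c c⊆c₀ =
      osp (coarsen A xs c) (⊑-IsDOSP (⊑-coarsen A xs c) (recompute-IsDOSP p)) ,ₛ (osp≤ (⊑-coarsen A xs c) , osp≤ ⊑ω)
      where
      ⊑ω : coarsen A xs c ⊑ ys
      ⊑ω = subst (coarsen A xs c ⊑_) (sym (⊑⇒≡coarsen fresh A∷xs⊑ys)) (coarsen-mono A xs c⊆c₀)

    toGaps : Interval ψ ω → Subset ∣ c₀ ∣
    toGaps (0̂        ,ₛ _) = ⊥
    toGaps (osp zs _ ,ₛ _) = restrict c₀ (mergedGaps A xs zs)

    fromGaps : Subset ∣ c₀ ∣ → Interval ψ ω
    fromGaps s = coarsen-∈ (expand c₀ s) (expand-⊆ c₀ s)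

    private
      ψ≰0̂ : ¬ (ψ ≤Ω 0̂)
      ψ≰0̂ ()

      ≡coarsen : ∀ {zs} .{r : IsDOSP d zs} → .(ψ ≤Ω osp zs r) → zs ≡ coarsen A xs (mergedGaps A xs zs)
      ≡coarsen ψ≤z = recompute (Listₚ.≡-dec _≟ₛ_ _ _) (⊑⇒≡coarsen fresh (≤Ω⇒⊑ ψ≤z))

      gaps⊆c₀ : ∀ {zs} .{r : IsDOSP d zs} → .(ψ ≤Ω osp zs r × osp zs r ≤Ω ω) → mergedGaps A xs zs ⊆ c₀
      gaps⊆c₀ ψ≤z≤ω = recompute (_ ⊆? _) (gaps (≤Ω⇒⊑ (proj₁ ψ≤z≤ω)) (≤Ω⇒⊑ (proj₂ ψ≤z≤ω)))

    toGaps-fromGaps : ∀ s → toGaps (fromGaps s) ≡ s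
    toGaps-fromGaps s = trans (cong (restrict c₀) (mergedGaps-coarsen A xs (expand c₀ s) fresh)) (restrict-expand c₀ s)

    fromGaps-toGaps : ∀ z → fromGaps (toGaps z) ≡ z
    fromGaps-toGaps (0̂        ,ₛ ψ≤0̂≤ω) = ⊥-elim-irr (ψ≰0̂ (proj₁ ψ≤0̂≤ω))
    fromGaps-toGaps (osp zs r ,ₛ ψ≤z≤ω) = Sub-≡ (osp-cong (begin
      coarsen A xs (expand c₀ (restrict c₀ (mergedGaps A xs zs)))
        ≡⟨ cong (coarsen A xs) (expand-restrict c₀ _ (gaps⊆c₀ ψ≤z≤ω)) ⟩
      coarsen A xs (mergedGaps A xs zs)
        ≡⟨ sym (≡coarsen (proj₁ ψ≤z≤ω)) ⟩
      zs
        ∎))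
      where open ≡-Reasoning

    toGaps-mono : ∀ z z′ → z ≤ᴵ z′ → toGaps z ⊆ toGaps z′
    toGaps-mono (0̂ ,ₛ ψ≤0̂≤ω) _ _ = ⊥-elim-irr (ψ≰0̂ (proj₁ ψ≤0̂≤ω))
    toGaps-mono (osp _ _ ,ₛ _) (0̂ ,ₛ ψ≤0̂≤ω) _ = ⊥-elim-irr (ψ≰0̂ (proj₁ ψ≤0̂≤ω))
    toGaps-mono (osp zs r ,ₛ ψ≤z≤ω) (osp zs′ r′ ,ₛ ψ≤z′≤ω) z≤z′ =
      restrict-mono c₀ (Equivalence.to (coarsen-⊑⇔ fresh _ _)
        (subst₂ _⊑_ (≡coarsen (proj₁ ψ≤z≤ω)) (≡coarsen (proj₁ ψ≤z′≤ω)) (≤Ω⇒⊑ z≤z′)))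

    toGaps-reflects : ∀ z z′ → toGaps z ⊆ toGaps z′ → z ≤ᴵ z′
    toGaps-reflects (0̂ ,ₛ ψ≤0̂≤ω) _ _ = ⊥-elim-irr (ψ≰0̂ (proj₁ ψ≤0̂≤ω))
    toGaps-reflects (osp _ _ ,ₛ _) (0̂ ,ₛ ψ≤0̂≤ω) _ = ⊥-elim-irr (ψ≰0̂ (proj₁ ψ≤0̂≤ω))
    toGaps-reflects (osp zs r ,ₛ ψ≤z≤ω) (osp zs′ r′ ,ₛ ψ≤z′≤ω) s⊆s′ =
      osp≤ (subst₂ _⊑_ (sym (≡coarsen (proj₁ ψ≤z≤ω))) (sym (≡coarsen (proj₁ ψ≤z′≤ω)))
             (coarsen-mono A xs (subst₂ _⊆_ (expand-restrict c₀ _ (gaps⊆c₀ ψ≤z≤ω))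
                                            (expand-restrict c₀ _ (gaps⊆c₀ ψ≤z′≤ω))
                                            (expand-mono c₀ s⊆s′))))

    interval≅gaps : OrderIso (Interval ψ ω) _≤ᴵ_ (𝓑 ∣ c₀ ∣) _≤𝓑_
    interval≅gaps = mk↔ₛ′ toGaps fromGaps toGaps-fromGaps fromGaps-toGaps ,
                    λ z z′ → toGaps-mono z z′ , toGaps-reflects z z′

    length+∣c₀∣ : length ys + ∣ c₀ ∣ ≡ suc (length xs)
    length+∣c₀∣ = trans (cong (λ zs → length zs + ∣ c₀ ∣) (⊑⇒≡coarsen fresh A∷xs⊑ys)) (length-coarsen A xs c₀)

  interval≅𝓑 : ∀ xs .(p : IsDOSP d xs) ys .(q : IsDOSP d ys) → osp xs p ≤Ω osp ys q →
               OrderIso (Interval (osp xs p) (osp ys q)) _≤ᴵ_ (𝓑 (ρ (osp ys q) ∸ ρ (osp xs p))) _≤𝓑_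
  interval≅𝓑 []       p ys q _   = contradiction refl (proj₁ (recompute-IsDOSP p))
  interval≅𝓑 (A ∷ xs) p ys q ψ≤ω =
    subst (λ k → OrderIso (Interval (osp (A ∷ xs) p) (osp ys q)) _≤ᴵ_ (𝓑 k) _≤𝓑_) ∣c₀∣≡
          (interval≅gaps A xs p ys q A∷xs⊑ys)
    where
    A∷xs⊑ys : A ∷ xs ⊑ ys
    A∷xs⊑ys = ≤Ω⇒⊑ ψ≤ω
    gaps# : ℕ
    gaps# = ∣ c₀ A xs p ys q A∷xs⊑ys ∣
    l+r≡ : length ys + gaps# ≡ suc (length xs)
    l+r≡ = length+∣c₀∣ A xs p ys q A∷xs⊑ys
    l+r≤1+N : length ys + gaps# ≤ suc N
    l+r≤1+N = subst (_≤ suc N) (sym l+r≡) (≤-trans (length≤N (recompute-IsDOSP p)) (n≤1+n N))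
    ∣c₀∣≡ : gaps# ≡ (suc N ∸ length ys) ∸ (suc N ∸ suc (length xs))
    ∣c₀∣≡ = sym (trans (cong (λ l → (suc N ∸ length ys) ∸ (suc N ∸ l)) (sym l+r≡))
                       ([a∸l]∸[a∸[l+r]]≡r (suc N) (length ys) gaps# l+r≤1+N))

  join : ∀ x y → Σ (Ω n d) (IsJoin x y)
  join 0̂ y = y , upper , λ z ub → ub y (inj₂ refl)
    where
    upper : ∀ w → w ≡ 0̂ ⊎ w ≡ y → w ≤Ω y
    upper w (inj₁ refl) = 0̂≤
    upper w (inj₂ refl) = ≤Ω-refl y
  join x@(osp _ _) 0̂ = x , upper , λ z ub → ub x (inj₁ refl)
    where
    upper : ∀ w → w ≡ x ⊎ w ≡ 0̂ → w ≤Ω x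
    upper w (inj₁ refl) = ≤Ω-refl x
    upper w (inj₂ refl) = 0̂≤
  join (osp [] p) (osp ys q) = contradiction refl (proj₁ (recompute-IsDOSP p))
  join x@(osp (A ∷ xs) p) y@(osp ys q) = x∨y , upper , least
    where
    isDOSPx : IsDOSP d (A ∷ xs)
    isDOSPx = recompute-IsDOSP p
    isDOSPy : IsDOSP d ys
    isDOSPy = recompute-IsDOSP q
    c : Subset (length xs)
    c = gapsOffChain (chain ys) ⊥ A xs
    x⊑ : A ∷ xs ⊑ coarsen A xs c
    x⊑ = ⊑-coarsen A xs c
    isDOSP∨ : IsDOSP d (coarsen A xs c)
    isDOSP∨ = ⊑-IsDOSP x⊑ isDOSPx
    x∨y : Ω n d
    x∨y = osp (coarsen A xs c) isDOSP∨
    upper : ∀ w → w ≡ x ⊎ w ≡ y → w ≤Ω x∨y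
    upper w (inj₁ refl) = osp≤ x⊑
    upper w (inj₂ refl) =
      osp≤ (chain⊆⇒⊑ isDOSPy isDOSP∨ λ P∈ → on-y (prefixUnions-gapsOffChain⁻ (chain ys) ⊥ A xs P∈))
      where
      on-y : ∀ {P} → P ∈ₗ chain ys ⊎ P ≡ foldl _∪_ (⊥ ∪ A) xs → P ∈ₗ chain ys
      on-y (inj₁ P∈) = P∈
      on-y (inj₂ refl) = subst (_∈ₗ chain ys) (sym (foldl-∪-⊤ ⊥ (A ∷ xs) (proj₁ (proj₂ (proj₂ (proj₂ isDOSPx))))))
                               (⊤∈chain isDOSPy)
    least : ∀ z → IsUpperBound (λ w → w ≡ x ⊎ w ≡ y) z → x∨y ≤Ω z
    least z ub with ub x (inj₁ refl) | ub y (inj₂ refl)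
    least (osp zs r) ub | osp≤ x⊑z | osp≤ y⊑z = osp≤ (chain⊆⇒⊑ isDOSP∨ (recompute-IsDOSP r)
      λ P∈ → prefixUnions-gapsOffChain⁺ (chain ys) ⊥ A xs (⊑⇒prefixUnions⊇ x⊑z P∈) (⊑⇒prefixUnions⊇ y⊑z P∈))

  meet : ∀ x y → Σ (Ω n d) (IsMeet x y)
  meet 0̂ y = 0̂ , (λ _ _ → 0̂≤) , λ z lb → lb 0̂ (inj₁ refl)
  meet (osp _ _) 0̂ = 0̂ , (λ _ _ → 0̂≤) , λ z lb → lb 0̂ (inj₂ refl)
  meet (osp [] p) (osp _ _) = contradiction refl (proj₁ (recompute-IsDOSP p))
  meet (osp (_ ∷ _) _) (osp [] q) = contradiction refl (proj₁ (recompute-IsDOSP q))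
  meet x@(osp (A ∷ xs) p) y@(osp (B ∷ ys) q)
    with meet? ⊥ A xs B ys (IsDOSP⇒IsDOSPOutside-⊥ (recompute-IsDOSP p)) (IsDOSP⇒IsDOSPOutside-⊥ (recompute-IsDOSP q))
  ... | inj₁ r = x∧y , lower , greatest
    where
    isDOSP∧ : IsDOSP d (blocks r)
    isDOSP∧ = IsDOSPOutside-⊥⇒IsDOSP (nonNil r) (valid r)
    x∧y : Ω n d
    x∧y = osp (blocks r) isDOSP∧
    lower : ∀ w → w ≡ x ⊎ w ≡ y → x∧y ≤Ω w
    lower w (inj₁ refl) = osp≤ (chain⊆⇒⊑ isDOSP∧ (recompute-IsDOSP p) (complete r ∘ inj₁))
    lower w (inj₂ refl) = osp≤ (chain⊆⇒⊑ isDOSP∧ (recompute-IsDOSP q) (complete r ∘ inj₂))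
    greatest : ∀ z → IsLowerBound (λ w → w ≡ x ⊎ w ≡ y) z → z ≤Ω x∧y
    greatest 0̂ _ = 0̂≤
    greatest (osp zs s) lb with lb x (inj₁ refl) | lb y (inj₂ refl)
    ... | osp≤ z⊑x | osp≤ z⊑y = osp≤ (chain⊆⇒⊑ (recompute-IsDOSP s) isDOSP∧
            (Sum.[ ⊑⇒prefixUnions⊇ z⊑x , ⊑⇒prefixUnions⊇ z⊑y ] ∘ sound r))
  ... | inj₂ none = 0̂ , (λ _ _ → 0̂≤) , greatest
    where
    greatest : ∀ z → IsLowerBound (λ w → w ≡ x ⊎ w ≡ y) z → z ≤Ω 0̂
    greatest 0̂ _ = 0̂≤
    greatest (osp zs s) lb with lb x (inj₁ refl) | lb y (inj₂ refl)
    ... | osp≤ z⊑x | osp≤ z⊑y =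
      ⊥-elim (none (chain zs) (prefixUnions-isChain ⊥ zs) (⊑⇒prefixUnions⊇ z⊑x) (⊑⇒prefixUnions⊇ z⊑y))

  module Counting (k : ℕ) where
    open Arrangements (_≟ₛ_ {n})

    OfCorank : Set
    OfCorank = Sub (Ω n d) (λ ω → IsOSP ω × N ∸ ρ ω ≡ k)

    Partitions : Set
    Partitions = DPartitions n d (suc k)

    length-members : ∀ (F : Family n) → IsDPartition d (suc k) F → length (members F) ≡ suc k
    length-members F (_ , _ , _ , _ , hasSize) =
      ↔⇒≡ (↔-sym hasSize ↔-∘ unique⇒Fin↔ _≟ₛ_ (members F) (members-unique F) (∈members⁻ _ F) (∈members⁺ _ F))

    enumerate : ∀ (F : Family n) → .(IsDPartition d (suc k) F) → Vec (Subset n) (suc k)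
    enumerate F pr = toVec (members F) (length-members F pr)

    enumerate-cong : ∀ {F G : Family n} .{pr : IsDPartition d (suc k) F} .{pr′ : IsDPartition d (suc k) G} →
                     F ≡ G → enumerate F pr ≡ enumerate G pr′
    enumerate-cong refl = refl

    ∈enumerate⁻ : ∀ {B} (F : Family n) .(pr : IsDPartition d (suc k) F) → B ∈ᵥ enumerate F pr → B ∈F F
    ∈enumerate⁻ F pr B∈ =
      ∈members⁻ _ F (subst (_ ∈ₗ_) (toList-toVec (members F) _) (∈ᵥ⇒∈toList (enumerate F pr) B∈))

    ∈enumerate⁺ : ∀ {B} (F : Family n) .(pr : IsDPartition d (suc k) F) → B ∈F F → B ∈ᵥ enumerate F pr
    ∈enumerate⁺ F pr B∈ =
      ∈toList⇒∈ᵥ (enumerate F pr) (subst (_ ∈ₗ_) (sym (toList-toVec (members F) _)) (∈members⁺ _ F B∈))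

    enumerate-injective : ∀ (F : Family n) .(pr : IsDPartition d (suc k) F) → InjectiveVec (enumerate F pr)
    enumerate-injective F pr = unique⇒injectiveVec (enumerate F pr) (subst Unique (sym (toList-toVec (members F) _)) (members-unique F))

    arrange-IsDOSP : ∀ (F : Family n) (pr : IsDPartition d (suc k) F) c → IsDOSP d (Vec.toList (arrange (enumerate F pr) c))
    arrange-IsDOSP F pr@(nonempty , disjoint , covers , divisible , _) c =
      (λ ()) ,
      All.tabulate (nonempty _ ∘ inF) ,
      unique⇒AllPairs (injectiveVec⇒unique w (arrange-injective v c (enumerate-injective F pr)))
                      (λ B∈ C∈ → disjoint _ _ (inF B∈) (inF C∈)) ,
      covers′ ,
      All.tabulate (divisible _ ∘ inF)
      where
      v : Vec (Subset n) (suc k)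
      v = enumerate F pr
      w : Vec (Subset n) (suc k)
      w = arrange v c
      inF : ∀ {B} → B ∈ₗ Vec.toList w → B ∈F F
      inF = ∈enumerate⁻ F pr ∘ ∈-arrange⁻ v c ∘ ∈toList⇒∈ᵥ w
      covers′ : ∀ i → Any (i ∈_) (Vec.toList w)
      covers′ i with covers i
      ... | B , B∈F , i∈B =
        Any.map (λ B≡ → subst (i ∈_) B≡ i∈B) (∈ᵥ⇒∈toList w (∈-arrange⁺ v c (∈enumerate⁺ F pr B∈F)))

    familyOf-IsDPartition : IsDOSP d xs → length xs ≡ suc k → IsDPartition d (suc k) (familyOf xs)
    familyOf-IsDPartition {xs = xs} (_ , nonempty , disjoint , covers , divisible) length≡ =
      (λ B → All.lookup nonempty ∘ ∈familyOf⁻ B xs) ,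
      (λ B C B∈ C∈ B≢C → pairwise (∈familyOf⁻ B xs B∈) (∈familyOf⁻ C xs C∈) B≢C) ,
      (λ i → let (B , B∈ , i∈B) = Membership.find (covers i) in B , ∈familyOf⁺ B xs B∈ , i∈B) ,
      (λ B → All.lookup divisible ∘ ∈familyOf⁻ B xs) ,
      subst (λ m → Fin m ↔ Sub (Subset n) (_∈F familyOf xs)) length≡
        (unique⇒Fin↔ _≟ₛ_ xs (disjoint-nonempty⇒unique disjoint nonempty) (∈familyOf⁺ _ xs) (∈familyOf⁻ _ xs))
      where
      pairwise : ∀ {B C} → B ∈ₗ xs → C ∈ₗ xs → B ≢ C → Disjoint B C
      pairwise B∈ C∈ B≢C with AllPairs-lookup disjoint B∈ C∈ B≢C
      ... | inj₁ B#C = B#C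
      ... | inj₂ C#B = disjoint-sym C#B

    length≡suc-k : ∀ xs .(p : IsDOSP d xs) → N ∸ ρ (osp xs p) ≡ k → length xs ≡ suc k
    length≡suc-k xs p corank≡k = trans (sym (suc[N∸ρ]≡length xs p)) (cong suc corank≡k)

    toOSP : LehmerCode (suc k) × Partitions → OfCorank
    toOSP (c , (F ,ₛ pr)) =
      osp (Vec.toList w) (arrange-IsDOSP F pr c) ,ₛ
      (tt , Nₚ.suc-injective (trans (suc[N∸ρ]≡length (Vec.toList w) (arrange-IsDOSP F pr c)) (Vecₚ.length-toList w)))
      where
      w : Vec (Subset n) (suc k)
      w = arrange (enumerate F pr) c

    familyOf-corank : ∀ xs .(p : IsDOSP d xs) → N ∸ ρ (osp xs p) ≡ k → IsDPartition d (suc k) (familyOf xs)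
    familyOf-corank xs p corank≡k = familyOf-IsDPartition (recompute-IsDOSP p) (length≡suc-k xs p corank≡k)

    fromOSP : OfCorank → LehmerCode (suc k) × Partitions
    fromOSP (0̂       ,ₛ pr) = ⊥-elim-irr (proj₁ pr)
    fromOSP (osp xs p ,ₛ pr) =
      codeOf (enumerate (familyOf xs) (familyOf-corank xs p (proj₂ pr))) (toVec xs (length≡suc-k xs p (proj₂ pr))) ,
      (familyOf xs ,ₛ familyOf-corank xs p (proj₂ pr))

    toOSP-fromOSP : ∀ t → toOSP (fromOSP t) ≡ t
    toOSP-fromOSP (0̂       ,ₛ pr) = ⊥-elim-irr (proj₁ pr)
    toOSP-fromOSP (osp xs p ,ₛ pr) = Sub-≡ (osp-cong (begin
      Vec.toList (arrange v (codeOf v w))   ≡⟨ cong Vec.toList (arrange-codeOf v w w-injective w⊆v) ⟩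
      Vec.toList w                          ≡⟨ toList-toVec xs _ ⟩
      xs                                    ∎))
      where
      open ≡-Reasoning
      isDOSP : IsDOSP d xs
      isDOSP = recompute-IsDOSP p
      v w : Vec (Subset n) (suc k)
      v = enumerate (familyOf xs) (familyOf-corank xs p (proj₂ pr))
      w = toVec xs (length≡suc-k xs p (proj₂ pr))
      w-injective : InjectiveVec w
      w-injective = unique⇒injectiveVec w (subst Unique (sym (toList-toVec xs _))
                      (disjoint-nonempty⇒unique (proj₁ (proj₂ (proj₂ isDOSP))) (proj₁ (proj₂ isDOSP))))
      w⊆v : ∀ j → Vec.lookup w j ∈ᵥ v
      w⊆v j = ∈enumerate⁺ (familyOf xs) (familyOf-corank xs p (proj₂ pr))
                (∈familyOf⁺ _ xs (subst (Vec.lookup w j ∈ₗ_) (toList-toVec xs _) (∈ᵥ⇒∈toList w (j , refl))))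

    fromOSP-toOSP : ∀ t → fromOSP (toOSP t) ≡ t
    fromOSP-toOSP (c , (F ,ₛ pr)) = cong₂ _,_ code≡ (Sub-≡ G≡F)
      where
      open ≡-Reasoning
      v w : Vec (Subset n) (suc k)
      v = enumerate F pr
      w = arrange v c
      G : Family n
      G = familyOf (Vec.toList w)
      G≡F : G ≡ F
      G≡F = family-ext G F
        (λ B → ∈enumerate⁻ F pr ∘ ∈-arrange⁻ v c ∘ ∈toList⇒∈ᵥ w ∘ ∈familyOf⁻ B (Vec.toList w))
        (λ B → ∈familyOf⁺ B (Vec.toList w) ∘ ∈ᵥ⇒∈toList w ∘ ∈-arrange⁺ v c ∘ ∈enumerate⁺ F pr)
      code≡ : proj₁ (fromOSP (toOSP (c , (F ,ₛ pr)))) ≡ c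
      code≡ = begin
        proj₁ (fromOSP (toOSP (c , (F ,ₛ pr))))
          ≡⟨ cong₂ codeOf (enumerate-cong {pr = subst (IsDPartition d (suc k)) (sym G≡F) pr} {pr′ = pr} G≡F)
                          (toVec-toList w (Vecₚ.length-toList w)) ⟩
        codeOf v w
          ≡⟨ codeOf-arrange v c (enumerate-injective F pr) ⟩
        c
          ∎

    OfCorank-count : ∀ m → Partitions HasSize m → OfCorank HasSize (suc k ! * m)
    OfCorank-count m hasSize =
      mk↔ₛ′ toOSP fromOSP toOSP-fromOSP fromOSP-toOSP ↔-∘ ((Fin[k!]↔LehmerCode (suc k) ×-↔ hasSize) ↔-∘ Finₚ.*↔×)


⊤-IsDOSP : ∀ {n d} → d ∣ suc n → IsDOSP d (⊤ {suc n} ∷ [])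
⊤-IsDOSP {n} {d} d∣1+n =
  (λ ()) , (zero , ∈⊤) ∷ [] , [] ∷ [] , (λ _ → here ∈⊤) , subst (d ∣_) (sym (∣⊤∣≡n (suc n))) d∣1+n ∷ []

⊑-⊤ : ∀ {d} → IsDOSP d xs → xs ⊑ ⊤ ∷ []
⊑-⊤ {xs = []}     (xs≢[] , _) = contradiction refl xs≢[]
⊑-⊤ {xs = A ∷ xs} (_ , _ , _ , covers , _) =
  subst₂ (λ ys S → A ∷ ys ⊑ S ∷ []) (Listₚ.++-identityʳ xs) ⋃≡⊤ (⊑-foldl-∪ A xs [])
  where
  ⋃≡⊤ : foldl _∪_ A xs ≡ ⊤
  ⋃≡⊤ = trans (cong (λ S → foldl _∪_ S xs) (sym (∪-identityˡ A))) (foldl-∪-⊤ ⊥ (A ∷ xs) covers)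

single-block-⊑ : A ∷ [] ⊑ ys → ys ≡ A ∷ []
single-block-⊑ ε              = refl
single-block-⊑ (there () ◅ _)

no-DOSP-of-∅ : ∀ {d} {xs : List (Subset 0)} → ¬ IsDOSP d xs
no-DOSP-of-∅ {xs = []}    (xs≢[] , _)          = xs≢[] refl
no-DOSP-of-∅ {xs = _ ∷ _} (_ , (() , _) ∷ _ , _)

1̂ : ∀ {d} n → d ∣ n → Ω n d
1̂ zero    _     = 0̂
1̂ (suc n) d∣1+n = osp (⊤ ∷ []) (⊤-IsDOSP d∣1+n)

module _ {d : ℕ} where

  ≤1̂ : ∀ n (d∣n : d ∣ n) x → x ≤Ω 1̂ n d∣n
  ≤1̂ n       d∣n 0̂          = 0̂≤
  ≤1̂ zero    d∣n (osp xs p) = ⊥-elim (no-DOSP-of-∅ (recompute-IsDOSP p))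
  ≤1̂ (suc n) d∣n (osp xs p) = osp≤ (⊑-⊤ (recompute-IsDOSP p))

  1̂-maximal : ∀ n (d∣n : d ∣ n) → Order.IsMaximal _≤Ω_ (1̂ n d∣n)
  1̂-maximal zero    d∣n 0̂          _           = refl
  1̂-maximal zero    d∣n (osp xs p) _           = ⊥-elim (no-DOSP-of-∅ (recompute-IsDOSP p))
  1̂-maximal (suc n) d∣n (osp ys q) (osp≤ ⊤⊑ys) = osp-cong (single-block-⊑ ⊤⊑ys)

  maximal⇒≡1̂ : ∀ n (d∣n : d ∣ n) x → Order.IsMaximal _≤Ω_ x → x ≡ 1̂ n d∣n
  maximal⇒≡1̂ n d∣n x x-maximal = sym (x-maximal (1̂ n d∣n) (≤1̂ n d∣n x))

  blocksOf-1̂ : ∀ n (d∣n : d ∣ n) → n ≢ 0 → blocksOf (1̂ n d∣n) ≡ just (⊤ ∷ [])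
  blocksOf-1̂ zero    _ 0≢0 = contradiction refl 0≢0
  blocksOf-1̂ (suc n) _ _   = refl

module _ (d′ : ℕ) where

  ρ-1̂ : ∀ n (d∣n : suc d′ ∣ n) → Poset.ρ d′ n d∣n (1̂ n d∣n) ≡ Poset.N d′ n d∣n
  ρ-1̂ zero    _   = refl
  ρ-1̂ (suc n) _   = refl

  upperInterval≅𝓑 : ∀ n (d∣n : suc d′ ∣ n) xs .(p : IsDOSP (suc d′) xs) →
                    OrderIso (Order.Interval _≤Ω_ (osp xs p) (1̂ n d∣n)) (Order._≤ᴵ_ _≤Ω_) (𝓑 (length xs ∸ 1)) _≤𝓑_
  upperInterval≅𝓑 zero    d∣n xs p = ⊥-elim (no-DOSP-of-∅ (recompute-IsDOSP p))
  upperInterval≅𝓑 (suc n) d∣n xs p =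
    subst (λ k → OrderIso (Order.Interval _≤Ω_ (osp xs p) (1̂ (suc n) d∣n)) (Order._≤ᴵ_ _≤Ω_) (𝓑 k) _≤𝓑_)
          (cong pred (Poset.suc[N∸ρ]≡length d′ (suc n) d∣n xs p))
          (Poset.interval≅𝓑 d′ (suc n) d∣n xs p (⊤ ∷ []) (⊤-IsDOSP d∣n) (≤1̂ (suc n) d∣n (osp xs p)))

  corank-count : ∀ n (d∣n : suc d′ ∣ n) k m → DPartitions n (suc d′) (suc k) HasSize m →
                 Sub (Ω n (suc d′)) (λ ω → IsOSP ω × Poset.ρ d′ n d∣n (1̂ n d∣n) ∸ Poset.ρ d′ n d∣n ω ≡ k)
                   HasSize (suc k ! * m)
  corank-count n d∣n k m hasSize =
    subst (λ r → Sub (Ω n (suc d′)) (λ ω → IsOSP ω × r ∸ Poset.ρ d′ n d∣n ω ≡ k) HasSize (suc k ! * m))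
          (sym (ρ-1̂ n d∣n)) (Poset.Counting.OfCorank-count d′ n d∣n k m hasSize)

-- Two atoms of Ω₃⁽¹⁾ with meet 0̂ whose join is 1̂, of rank 3: the join does not cover them.
module Counterexample where
  open Poset 0 3 (divides 3 refl)
  open Order (_≤Ω_ {3} {1}) using (Semimodular)

  singletons : List (Subset 3)
  singletons = ⁅ zero ⁆ ∷ ⁅ suc zero ⁆ ∷ ⁅ suc (suc zero) ⁆ ∷ []

  ω₁ ω₂ : Ω 3 1
  ω₁ = osp singletons (toWitness {a? = isDOSP? 1 singletons} tt)
  ω₂ = osp (Data.List.reverse singletons) (toWitness {a? = isDOSP? 1 (Data.List.reverse singletons)} tt)

  ¬semimodular : ¬ Semimodular
  ¬semimodular semimodular with
    semimodular ω₁ ω₂ _ _ (proj₂ (meet ω₁ ω₂)) (proj₂ (join ω₁ ω₂))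
                (sizes≡d⇒atom _ _ (refl ∷ refl ∷ refl ∷ [])) (sizes≡d⇒atom _ _ (refl ∷ refl ∷ refl ∷ []))
  ... | ω₁⋖ω₁∨ω₂ , _ with ρ-⋖ ω₁ _ ω₁⋖ω₁∨ω₂
  ... | ()

mainTheorem1 :
  ((d n : ℕ) → .{{_ : NonZero d}} → d ∣ n →
    let open Order (_≤Ω_ {n} {d}) in
    let open WithBottom 0̂ in
    -- (a) unique maximal element 1̂, equal to ([n]) (for n = 0, Ω = {0̂})
    Σ (Ω n d) λ 1̂ →
      (IsMaximal 1̂ × (∀ x → IsMaximal x → x ≡ 1̂) × (n ≢ 0 → blocksOf 1̂ ≡ just (⊤ ∷ [])))
    -- (b) atoms
    × (∀ x → IsAtom x ⇔ AllBlocksOfSize d x)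
    -- (c), (e): ranked, rank formula, corank counts, intervals [ψ, ω]
    × (Σ (Ω n d → ℕ) λ ρ →
        IsRankFunction ρ
        × (∀ bs .(p : IsDOSP d bs) → ρ (osp bs p) + length bs ≡ n / d + 1)
        × (∀ k m → DPartitions n d (suc k) HasSize m →
             Sub (Ω n d) (λ ω → IsOSP ω × ρ 1̂ ∸ ρ ω ≡ k) HasSize (suc k ! * m))
        × (∀ bs .(p : IsDOSP d bs) cs .(q : IsDOSP d cs) →
             osp bs p ≤Ω osp cs q →
             OrderIso (Interval (osp bs p) (osp cs q)) _≤ᴵ_
                      (𝓑 (ρ (osp cs q) ∸ ρ (osp bs p))) _≤𝓑_))
    -- (d) [ω, 1̂] ≅ 𝓑 (k - 1)
    × (∀ bs .(p : IsDOSP d bs) →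
         OrderIso (Interval (osp bs p) 1̂) _≤ᴵ_ (𝓑 (length bs ∸ 1)) _≤𝓑_)
    -- (f) atomic lattice
    × IsLattice × IsAtomic)
  -- (f) not semimodular in general
  × (Σ ℕ λ d → Σ ℕ λ n → NonZero d × d ∣ n × ¬ Order.Semimodular (_≤Ω_ {n} {d}))
mainTheorem1 = (λ where
    zero     n {{d≢0}} _ → ⊥-elim-irr (NonZero.nonZero d≢0)
    (suc d′) n d∣n →
      let open Poset d′ n d∣n in
      1̂ n d∣n , (1̂-maximal n d∣n , maximal⇒≡1̂ n d∣n , blocksOf-1̂ n d∣n) , atom⇔sizes≡d ,
      (ρ , ρ-isRankFunction , ρ+length , corank-count d′ n d∣n , interval≅𝓑) ,
      upperInterval≅𝓑 d′ n d∣n , (λ x y → join x y , meet x y) , isAtomic)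
  , (1 , 3 , _ , divides 3 refl , Counterexample.¬semimodular)
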